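{- Let $f(D)$ and $g(D)$ be delta operators and let $\sigma_f$, $\sigma_g$ be the Roman shifts relative to their associated graded sequences. Then $$\sigma_f=\sigma_g\circ\bigl(\sigma_f^*(g(D))\bigr),$$ where $\sigma_f^*(g(D))$ is the Artinian operator obtained by applying the adjoint of $\sigma_f$ to $g(D)$.
   Context: Setting (discrete case of the logarithmic umbral calculus). For $a\in\mathbb{Z}$ let $\lfloor a\rceil=a$ if $a\neq0$, $\lfloor 0\rceil=1$; $\lfloor a\rceil!=a!$ for $a\ge0$, $\lfloor a\rceil!=(-1)^{ -a-1}/(-a-1)!$ for $a<0$. Harmonic logarithms $\lambda_a^\alpha(x)$ ($a\in\mathbb{Z}$, $\alpha$ a logarithmic index): $\lambda_a^{(0)}=x^a$ for $a\ge0$, $0$ for $a<0$; $\lambda_a^{(1)}=x^a(\log x-H_a)$ for $a\ge0$, $x^a$ for $a<0$; higher indices involve iterated logarithms. $\mathcal{I}^\alpha$: formal series $\sum_{b\le N}c_b\lambda_b^\alpha$. $D\lambda_a^\alpha=\lfloor a\rceil\lambda_{a-1}^\alpha$; Artinian operators $\sum_{a\ge k}c_aD^a$ (field $\Lambda^+$) act via $D^b\lambda_a^\alpha=\frac{\lfloor a\rceil!}{\lfloor a-b\rceil!}\lambda_{a-b}^\alpha$; delta operators are $\sum_{a\ge1}c_aD^a$ with $c_1\ne0$. $\langle\alpha\mid p\rangle$ = coefficient of $\lambda_0^\alpha$ in $p$. A graded sequence is a regular family $(p_a^\alpha)$, $p_a^\alpha\in\mathcal{I}^\alpha$ of degree $a$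 (coefficients independent of $\alpha\ne(0)$; $p_a^{(0)}$ obtained from $p_a^{(1)}$ by $\lambda_b^{(1)}\mapsto\lambda_b^{(0)}$). The associated graded sequence of a delta operator $f(D)$ is the unique graded sequence with $\langle\alpha\mid p_0^\alpha\rangle=1$, $\langle\alpha\mid p_a^\alpha\rangle=0$ ($a\ne0$), $f(D)p_a^\alpha=\lfloor a\rceil p_{a-1}^\alpha$. The Roman shift $\sigma_f$ relative to it is the linear operator with $\sigma_fp_a^\alpha=p_{a+1}^\alpha$ for $a\ne-1$ and $\sigma_fp_{ -1}^\alpha=0$. The adjoint $\theta^*:\Lambda^+\to\Lambda^+$ is defined by $\langle\alpha\mid(\theta^*h)(D)p\rangle=\langle\alpha\mid h(D)\theta p\rangle$ for all $\alpha\ne(0)$, $p\in\mathcal{I}^\alpha$, $h\in\Lambda^+$. -}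

module Defs where

open import Level using (Level; _⊔_) renaming (suc to lsuc)
open import Data.Bool using (Bool; true; false; if_then_else_; _∧_; not)
open import Data.Nat using (ℕ; zero; suc; _!)
open import Data.Nat.Properties using (_!≢0)
open import Data.Integer as Z using (ℤ; +_; -[1+_]; 0ℤ; 1ℤ; ∣_∣)
import Data.Integer.Properties as ZP
open import Data.Rational as Q using (ℚ)
open import Data.Product using (Σ; _×_)
open import Data.Sum using (_⊎_)
open import Relation.Nullary using (¬_; does)
open import Relation.Binary.PropositionalEquality using (_≡_)
open import Algebra.Bundles using (CommutativeRing)

-- A field of characteristic zero, presented as a field K together with
-- a unital ring homomorphism ℚ → K (which exists, uniquely, exactly when
-- char K = 0).

record CharZeroField (c ℓ : Level) : Set (lsuc (c ⊔ ℓ)) where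
  field
    commRing : CommutativeRing c ℓ
  open CommutativeRing commRing public
  field
    nontrivial : ¬ (1# ≈ 0#)
    inverse    : ∀ x → ¬ (x ≈ 0#) → Σ Carrier (λ y → x * y ≈ 1#)
    fromℚ      : ℚ → Carrier
    fromℚ-1    : fromℚ Q.1ℚ ≈ 1#
    fromℚ-+    : ∀ p q → fromℚ (p Q.+ q) ≈ fromℚ p + fromℚ q
    fromℚ-*    : ∀ p q → fromℚ (p Q.* q) ≈ fromℚ p * fromℚ q

brk : ℤ → ℤ
brk (+ zero)  = 1ℤ
brk a         = a

-- ⌊a⌉! : a! for a ≥ 0, (-1)^(-a-1)/(-a-1)! for a < 0
sgn : ℕ → ℤ
sgn zero    = 1ℤ
sgn (suc n) = Z.- sgn n

brkFact : ℤ → ℚ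
brkFact (+ n)    = (+ (n !)) Q./ 1
brkFact -[1+ n ] = Q._/_ (sgn n) (n !) {{n !≢0}}

brkFactInv : ℤ → ℚ
brkFactInv (+ n)    = Q._/_ (+ 1) (n !) {{n !≢0}}
brkFactInv -[1+ n ] = (sgn n Z.* + (n !)) Q./ 1

factRatio : ℤ → ℤ → ℚ
factRatio a b = brkFact a Q.* brkFactInv b

module Theory {c ℓ} (F : CharZeroField c ℓ) where
  open CharZeroField F

  K : Set c
  K = Carrier

  sumFrom : ℤ → ℕ → (ℤ → K) → K
  sumFrom lo zero    f = 0#
  sumFrom lo (suc n) f = f lo + sumFrom (lo Z.+ 1ℤ) n f

  sumRange : ℤ → ℤ → (ℤ → K) → K
  sumRange lo hi f = sumFrom lo (if lo Z.≤ᵇ hi then suc ∣ hi Z.- lo ∣ else 0) f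

  -- Elements of I^α :  Σ_{b ≤ top} coeff b · λ_b^α .
  -- Since the D-action and ⟨α | ·⟩ do not depend on α ≠ (0), one
  -- coefficient model serves every α ≠ (0); the flag z = true stands for
  -- α = (0), where λ_b^(0) = 0 for b < 0, so coefficients at negative b
  -- are meaningless (ignored by equality, masked by operators).

  record Series : Set c where
    constructor mkSeries
    field
      top   : ℤ
      coeff : ℤ → K
  open Series public

  -- is λ_m^α a nonzero basis element (α = (0) iff z = true)?
  Visible : Bool → ℤ → Set
  Visible z m = (z ≡ false) ⊎ (0ℤ Z.≤ m)

  Bounded : Bool → Series → Set ℓ
  Bounded z s = ∀ m → top s Z.< m → Visible z m → coeff s m ≈ 0#

  _≈[_]_ : Series → Bool → Series → Set ℓ
  s ≈[ z ] t = ∀ m → Visible z m → coeff s m ≈ coeff t m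

  mask : Bool → Series → ℤ → K
  mask z s m = if z ∧ not (0ℤ Z.≤ᵇ m) then 0# else coeff s m

  ⟨_⟩ : Series → K
  ⟨ s ⟩ = coeff s 0ℤ

  scale : K → Series → Series
  scale x s = mkSeries (top s) (λ m → x * coeff s m)

  -- Artinian operators  Σ_{a ≥ low} opCoeff a · D^a  (elements of Λ^+)

  record Op : Set c where
    constructor mkOp
    field
      low     : ℤ
      opCoeff : ℤ → K
  open Op public

  effCoeff : Op → ℤ → K
  effCoeff h a = if low h Z.≤ᵇ a then opCoeff h a else 0#

  IsDelta : Op → Set ℓ
  IsDelta f = (∀ a → a Z.≤ 0ℤ → effCoeff f a ≈ 0#) × ¬ (effCoeff f 1ℤ ≈ 0#)

  -- action on I^α using  D^a λ_j = ⌊j⌉!/⌊j-a⌉! λ_{j-a}: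
  -- coefficient of λ_m in h(D) s is Σ_{low ≤ a ≤ top - m} h_a s_{m+a} ⌊m+a⌉!/⌊m⌉!
  act : Bool → Op → Series → Series
  act z h s = mkSeries (top s Z.- low h)
    (λ m → sumRange (low h) (top s Z.- m)
             (λ a → opCoeff h a * (fromℚ (factRatio (m Z.+ a) m) * mask z s (m Z.+ a))))

  -- Graded sequences (coefficients independent of α; p^(0) obtained by
  -- λ^(1)_b ↦ λ^(0)_b, i.e. the same coefficients read with z = true)

  Family : Set c
  Family = ℤ → Series

  HasDegree : Series → ℤ → Set ℓ
  HasDegree s a = ¬ (coeff s a ≈ 0#) × (∀ m → a Z.< m → coeff s m ≈ 0#)

  IsGraded : Family → Set ℓ
  IsGraded p = ∀ a → Bounded false (p a) × HasDegree (p a) a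

  IsAssociated : Op → Family → Set ℓ
  IsAssociated f p =
    IsGraded p
    × (⟨ p 0ℤ ⟩ ≈ 1#)
    × (∀ a → ¬ (a ≡ 0ℤ) → ⟨ p a ⟩ ≈ 0#)
    × (∀ z a → act z f (p a) ≈[ z ] scale (fromℚ (brk a Q./ 1)) (p (a Z.- 1ℤ)))

  -- Σ_{b ≤ N} d_b p_b  (coefficientwise a finite sum since deg p_b = b)
  combo : Family → (ℤ → K) → ℤ → Series
  combo p d N = mkSeries N (λ m → sumRange m N (λ b → d b * coeff (p b) m))

  -- e_c = d_{c-1} for c ≠ 0 and e_0 = 0, so that
  -- Σ_{c ≤ N+1} e_c p_c = Σ_{b ≤ N, b ≠ -1} d_b p_{b+1}
  shiftCoeffs : (ℤ → K) → ℤ → K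
  shiftCoeffs d c = if does (c Z.≟ 0ℤ) then 0# else d (c Z.- 1ℤ)

  -- σ (one map on each I^α, z = true for α = (0)) is the Roman shift
  -- relative to p: the linear operator on I^α with σ p_a = p_{a+1}
  -- (a ≠ -1), σ p_{-1} = 0, extended to the formal series Σ_{b≤N} d_b p_b.
  IsRomanShift : Family → (Bool → Series → Series) → Set (c ⊔ ℓ)
  IsRomanShift p σ =
    (∀ z s → Bounded z s → Bounded z (σ z s))
    × (∀ z s t → Bounded z s → Bounded z t → s ≈[ z ] t → σ z s ≈[ z ] σ z t)
    × (∀ z d N → σ z (combo p d N) ≈[ z ] combo p (shiftCoeffs d) (N Z.+ 1ℤ))

  IsAdjointImage : (Bool → Series → Series) → Op → Op → Set (c ⊔ ℓ)
  IsAdjointImage θ h k = ∀ s → Bounded false s → ⟨ act false k s ⟩ ≈ ⟨ act false h (θ false s) ⟩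

-- In normalised coordinates (the coefficient of λ_m multiplied by ⌊m⌉!) D shifts
-- coefficients, and δ : λ_j ↦ λ_{j+1} (j ≠ -1), λ_{-1} ↦ 0 is the Roman shift of D, with the
-- Pincherle rule h(D) δ = δ h(D) + h′(D).  For a delta operator f the operator δ f′(D)⁻¹
-- therefore satisfies f(D) δ f′(D)⁻¹ = δ f′(D)⁻¹ f(D) + 1, so by uniqueness of associated
-- sequences it sends p_b to p_{b+1} (b ≠ -1) and p_{-1} to 0: σ_f = δ f′(D)⁻¹.  Hence
-- σ_g ∘ g′(D) f′(D)⁻¹ = δ g′(D)⁻¹ g′(D) f′(D)⁻¹ = σ_f, while ⟨α | h(D) δ p⟩ = ⟨α | h′(D) p⟩
-- shows σ_f^*(g(D)) = g′(D) f′(D)⁻¹; the adjoint is unique since ⟨α | k(D) λ_j⟩ = ⌊j⌉! k_j.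
-- For α = (0) the argument is applied to the coefficients of the λ_m with m ≥ 0.

module Submission where

open import Defs
open import Data.Bool using (Bool; true; false; if_then_else_; not)
open import Data.Bool.Properties using (if-cong; T-≡)
open import Function.Bundles using (Equivalence)
open import Data.Product using (Σ; _×_; _,_; proj₁; proj₂)
open import Data.Sum using (inj₁; inj₂)
open import Data.Empty using (⊥; ⊥-elim)
open import Data.Maybe using (Maybe; just; nothing)
open import Data.Nat as ℕ using (ℕ; zero; suc; _!)
import Data.Nat.Properties as ℕP
open import Data.Integer as ℤ
  using (ℤ; +_; -[1+_]; 0ℤ; 1ℤ; -1ℤ; ∣_∣; _≤_; _<_; _≤ᵇ_; _⊔_; _⊓_)
  renaming (_+_ to _+ᶻ_; _-_ to _-ᶻ_; -_ to -ᶻ_; _*_ to _*ᶻ_)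
import Data.Integer.Properties as ℤP
open import Data.Integer.Tactic.RingSolver using (solve-∀)
open import Data.Rational as ℚ using (ℚ; _/_)
import Data.Rational.Properties as ℚP
open import Data.Rational.Unnormalised as ℚᵘ using (ℚᵘ; mkℚᵘ; *≡*)
import Data.Rational.Unnormalised.Properties as ℚᵘP
open import Relation.Nullary using (¬_; Dec; yes; no; does)
open import Relation.Nullary.Decidable using (dec-true; dec-false)
open import Relation.Binary.PropositionalEquality as ≡
  using (_≡_; _≢_; cong; cong₂; subst; subst₂)
open import Relation.Binary.Bundles using (Setoid)
open import Algebra.Bundles using (CommutativeRing)
import Relation.Binary.Reasoning.Setoid as SetoidReasoning
import Algebra.Properties.Ring as RingProperties
open import Algebra.Properties.AbelianGroup ℤP.+-0-abelianGroup using () renaming (∙-cancelʳ to +ᶻ-cancelʳ)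
import Algebra.Properties.CommutativeSemigroup as CommutativeSemigroupProperties
open import Algebra.Solver.Ring.AlmostCommutativeRing
  using (_-Raw-AlmostCommutative⟶_)
  renaming (fromCommutativeRing to toAlmostCommutativeRing)
import Algebra.Solver.Ring as RingSolver

<⇒+1≤ : ∀ {i j} → i < j → i +ᶻ 1ℤ ≤ j
<⇒+1≤ {i} {j} p = subst (_≤ j) (ℤP.+-comm 1ℤ i) (ℤP.i<j⇒suc[i]≤j p)

+1≤⇒< : ∀ {i j} → i +ᶻ 1ℤ ≤ j → i < j
+1≤⇒< {i} {j} p = ℤP.suc[i]≤j⇒i<j (subst (_≤ j) (ℤP.+-comm i 1ℤ) p)

<⇒≤-1 : ∀ {i j} → i < j → i ≤ j -ᶻ 1ℤ
<⇒≤-1 {i} {j} p = subst (_≤ j -ᶻ 1ℤ) (cancel i) (ℤP.+-monoˡ-≤ -1ℤ (<⇒+1≤ p))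
  where cancel : ∀ i → i +ᶻ 1ℤ -ᶻ 1ℤ ≡ i
        cancel = solve-∀

≤-1⇒< : ∀ {i j} → i ≤ j -ᶻ 1ℤ → i < j
≤-1⇒< {i} {j} p = +1≤⇒< (subst (i +ᶻ 1ℤ ≤_) (cancel j) (ℤP.+-monoˡ-≤ 1ℤ p))
  where cancel : ∀ j → j -ᶻ 1ℤ +ᶻ 1ℤ ≡ j
        cancel = solve-∀

i<i+1 : ∀ i → i < i +ᶻ 1ℤ
i<i+1 i = +1≤⇒< ℤP.≤-refl

≤ᵇ-≤ : ∀ {i j} → i ≤ j → (i ≤ᵇ j) ≡ true
≤ᵇ-≤ i≤j = Equivalence.to T-≡ (ℤP.≤⇒≤ᵇ i≤j)

≤ᵇ-> : ∀ {i j} → j < i → (i ≤ᵇ j) ≡ false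
≤ᵇ-> {i} {j} j<i with i ≤ᵇ j in i≤ᵇj
... | false = ≡.refl
... | true  = ⊥-elim (ℤP.<⇒≱ j<i (ℤP.≤ᵇ⇒≤ (Equivalence.from T-≡ i≤ᵇj)))

≤⇒≡+∣-∣ : ∀ {i j} → i ≤ j → j ≡ i +ᶻ + ∣ j -ᶻ i ∣
≤⇒≡+∣-∣ {i} {j} i≤j = ≡.trans (split i j) (cong (i +ᶻ_) (≡.sym (ℤP.0≤i⇒+∣i∣≡i (ℤP.i≤j⇒0≤j-i i≤j))))
  where split : ∀ i j → j ≡ i +ᶻ (j -ᶻ i)
        split = solve-∀

i-j<k⇒i-k<j : ∀ {i j k} → i -ᶻ j < k → i -ᶻ k < j
i-j<k⇒i-k<j {i} {j} {k} i-j<k = subst₂ _<_ (regroup i j k) (cancel j k) (ℤP.+-monoˡ-< (j -ᶻ k) i-j<k)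
  where regroup : ∀ i j k → i -ᶻ j +ᶻ (j -ᶻ k) ≡ i -ᶻ k
        regroup = solve-∀
        cancel : ∀ j k → k +ᶻ (j -ᶻ k) ≡ j
        cancel = solve-∀

i≤+∣i∣ : ∀ i → i ≤ + ∣ i ∣
i≤+∣i∣ (+ n)    = ℤP.≤-refl
i≤+∣i∣ -[1+ n ] = ℤP.<⇒≤ ℤ.-<+

-+∣i∣≤i : ∀ i → -ᶻ + ∣ i ∣ ≤ i
-+∣i∣≤i (+ zero)  = ℤP.≤-refl
-+∣i∣≤i (+ suc n) = ℤP.<⇒≤ ℤ.-<+
-+∣i∣≤i -[1+ n ]  = ℤP.≤-refl

private
  fromℚᵘ-homo-+ : ∀ x y → ℚ.fromℚᵘ x ℚ.+ ℚ.fromℚᵘ y ≡ ℚ.fromℚᵘ (x ℚᵘ.+ y)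
  fromℚᵘ-homo-+ x y = ≡.trans (≡.sym (ℚP.fromℚᵘ-toℚᵘ _)) (ℚP.fromℚᵘ-cong
    (ℚᵘP.≃-trans (ℚP.toℚᵘ-homo-+ (ℚ.fromℚᵘ x) (ℚ.fromℚᵘ y))
                 (ℚᵘP.+-cong (ℚP.toℚᵘ-fromℚᵘ x) (ℚP.toℚᵘ-fromℚᵘ y))))

  fromℚᵘ-homo-* : ∀ x y → ℚ.fromℚᵘ x ℚ.* ℚ.fromℚᵘ y ≡ ℚ.fromℚᵘ (x ℚᵘ.* y)
  fromℚᵘ-homo-* x y = ≡.trans (≡.sym (ℚP.fromℚᵘ-toℚᵘ _)) (ℚP.fromℚᵘ-cong
    (ℚᵘP.≃-trans (ℚP.toℚᵘ-homo-* (ℚ.fromℚᵘ x) (ℚ.fromℚᵘ y))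
                 (ℚᵘP.*-cong (ℚP.toℚᵘ-fromℚᵘ x) (ℚP.toℚᵘ-fromℚᵘ y))))

/1-homo-+ : ∀ a b → (a / 1) ℚ.+ (b / 1) ≡ (a +ᶻ b) / 1
/1-homo-+ a b = ≡.trans (fromℚᵘ-homo-+ (mkℚᵘ a 0) (mkℚᵘ b 0)) (ℚP.fromℚᵘ-cong {mkℚᵘ a 0 ℚᵘ.+ mkℚᵘ b 0} {mkℚᵘ (a +ᶻ b) 0} (*≡* (ring a b)))
  where ring : ∀ a b → (a *ᶻ 1ℤ +ᶻ b *ᶻ 1ℤ) *ᶻ 1ℤ ≡ (a +ᶻ b) *ᶻ 1ℤ
        ring = solve-∀

/1-homo-* : ∀ a b → (a / 1) ℚ.* (b / 1) ≡ (a *ᶻ b) / 1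
/1-homo-* a b = ≡.trans (fromℚᵘ-homo-* (mkℚᵘ a 0) (mkℚᵘ b 0)) (ℚP.fromℚᵘ-cong {mkℚᵘ a 0 ℚᵘ.* mkℚᵘ b 0} {mkℚᵘ (a *ᶻ b) 0} (*≡* ≡.refl))

/1-nonZero : ∀ {a} → a ≢ 0ℤ → ℚ.NonZero (a / 1)
/1-nonZero {a} a≢0 = ℚ.≢-nonZero λ a/1≡0 → a≃0⇒⊥ (ℚP.fromℚᵘ-injective {mkℚᵘ a 0} {mkℚᵘ 0ℤ 0} a/1≡0)
  where a≃0⇒⊥ : mkℚᵘ a 0 ℚᵘ.≃ mkℚᵘ 0ℤ 0 → ⊥
        a≃0⇒⊥ (*≡* a*1≡0) = a≢0 (≡.trans (≡.sym (ℤP.*-identityʳ a)) a*1≡0)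

private
  reciprocal : ∀ a b k → a *ᶻ b ≡ + suc k → (a / 1) ℚ.* (b / suc k) ≡ ℚ.1ℚ
  reciprocal a b k ab≡d = ≡.trans (fromℚᵘ-homo-* (mkℚᵘ a 0) (mkℚᵘ b k))
    (ℚP.fromℚᵘ-cong {mkℚᵘ a 0 ℚᵘ.* mkℚᵘ b k} {mkℚᵘ 1ℤ 0} (*≡* (begin
      (a *ᶻ b) *ᶻ 1ℤ          ≡⟨ ℤP.*-identityʳ _ ⟩
      a *ᶻ b                  ≡⟨ ab≡d ⟩
      + suc k                 ≡⟨ cong +_ (ℕP.*-identityˡ (suc k)) ⟨
      + (1 ℕ.* suc k)         ≡⟨ ℤP.*-identityˡ _ ⟨
      1ℤ *ᶻ + (1 ℕ.* suc k)   ∎)))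
    where
    open ≡.≡-Reasoning

  sgn²≡1 : ∀ n → sgn n *ᶻ sgn n ≡ 1ℤ
  sgn²≡1 zero    = ≡.refl
  sgn²≡1 (suc n) = ≡.trans (neg-square (sgn n)) (sgn²≡1 n)
    where neg-square : ∀ s → (-ᶻ s) *ᶻ (-ᶻ s) ≡ s *ᶻ s
          neg-square = solve-∀

brkFact-inverse : ∀ m → brkFact m ℚ.* brkFactInv m ≡ ℚ.1ℚ
brkFact-inverse (+ n) with n ! | ℕP._!≢0 n
... | suc k | _ = reciprocal (+ suc k) 1ℤ k (ℤP.*-identityʳ _)
brkFact-inverse -[1+ n ] with n ! | ℕP._!≢0 n
... | suc k | _ = ≡.trans (ℚP.*-comm (sgn n / suc k) _)
  (reciprocal (sgn n *ᶻ + suc k) (sgn n) k (≡.trans (swap (sgn n) (+ suc k)) (≡.trans (cong (_*ᶻ + suc k) (sgn²≡1 n)) (ℤP.*-identityˡ _))))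
  where swap : ∀ s d → (s *ᶻ d) *ᶻ s ≡ (s *ᶻ s) *ᶻ d
        swap = solve-∀

module Umbral {c ℓ} (F : CharZeroField c ℓ) where
  open CharZeroField F hiding (zero)
  open Theory F
  open SetoidReasoning setoid
  open RingProperties ring
    using (-0#≈0#; -‿+-comm; x[y-z]≈xy-xz; x+x≈x⇒x≈0; +-inverseˡ-unique)
  open CommutativeSemigroupProperties +-commutativeSemigroup using (interchange)

  ≡⇒≈ : ∀ {x y} → x ≡ y → x ≈ y
  ≡⇒≈ ≡.refl = refl

  *-cancelʳ : ∀ {x y z} → ¬ (z ≈ 0#) → x * z ≈ y * z → x ≈ y
  *-cancelʳ {x} {y} {z} z≉0 xz≈yz = begin
    x                ≈⟨ *-identityʳ x ⟨
    x * 1#           ≈⟨ *-congˡ (proj₂ (inverse z z≉0)) ⟨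
    x * (z * z⁻¹)    ≈⟨ *-assoc x z z⁻¹ ⟨
    (x * z) * z⁻¹    ≈⟨ *-congʳ xz≈yz ⟩
    (y * z) * z⁻¹    ≈⟨ *-assoc y z z⁻¹ ⟩
    y * (z * z⁻¹)    ≈⟨ *-congˡ (proj₂ (inverse z z≉0)) ⟩
    y * 1#           ≈⟨ *-identityʳ y ⟩
    y                ∎
    where z⁻¹ = proj₁ (inverse z z≉0)

  cancel-nonzeroʳ : ∀ {x y} → ¬ (y ≈ 0#) → x * y ≈ 0# → x ≈ 0#
  cancel-nonzeroʳ y≉0 xy≈0 = *-cancelʳ y≉0 (trans xy≈0 (sym (zeroˡ _)))

  ι : ℤ → K
  ι a = fromℚ (a / 1)

  ι-+ : ∀ a b → ι (a +ᶻ b) ≈ ι a + ι b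
  ι-+ a b = trans (≡⇒≈ (cong fromℚ (≡.sym (/1-homo-+ a b)))) (fromℚ-+ _ _)

  ι-0 : ι 0ℤ ≈ 0#
  ι-0 = x+x≈x⇒x≈0 _ (sym (fromℚ-+ ℚ.0ℚ ℚ.0ℚ))

  ι-1 : ι 1ℤ ≈ 1#
  ι-1 = fromℚ-1

  ι-neg : ∀ a → ι (-ᶻ a) ≈ - ι a
  ι-neg a = +-inverseˡ-unique (ι (-ᶻ a)) (ι a) (begin
    ι (-ᶻ a) + ι a     ≈⟨ ι-+ (-ᶻ a) a ⟨
    ι (-ᶻ a +ᶻ a)      ≡⟨ cong ι (ℤP.+-inverseˡ a) ⟩
    ι 0ℤ               ≈⟨ ι-0 ⟩
    0#                 ∎)

  ι-* : ∀ a b → ι (a *ᶻ b) ≈ ι a * ι b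
  ι-* a b = trans (≡⇒≈ (cong fromℚ (≡.sym (/1-homo-* a b)))) (fromℚ-* _ _)

  ι-nonzero : ∀ {a} → a ≢ 0ℤ → ¬ (ι a ≈ 0#)
  ι-nonzero {a} a≢0 ιa≈0 = nontrivial (begin
    1#                                  ≈⟨ fromℚ-1 ⟨
    fromℚ ℚ.1ℚ                          ≡⟨ cong fromℚ (ℚP.*-inverseʳ (a / 1) {{nz}}) ⟨
    fromℚ ((a / 1) ℚ.* ℚ.1/_ (a / 1) {{nz}}) ≈⟨ fromℚ-* _ _ ⟩
    ι a * fromℚ (ℚ.1/_ (a / 1) {{nz}})  ≈⟨ *-congʳ ιa≈0 ⟩
    0# * _                              ≈⟨ zeroˡ _ ⟩
    0#                                  ∎)
    where nz = /1-nonZero a≢0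

  ι-morphism : CommutativeRing.rawRing ℤP.+-*-commutativeRing
               -Raw-AlmostCommutative⟶ toAlmostCommutativeRing commRing
  ι-morphism = record
    { ⟦_⟧ = ι ; +-homo = ι-+ ; *-homo = ι-* ; -‿homo = ι-neg ; 0-homo = ι-0 ; 1-homo = ι-1 }

  ι-≟ : ∀ a b → Maybe (ι a ≈ ι b)
  ι-≟ a b with a ℤ.≟ b
  ... | yes ≡.refl = just refl
  ... | no _       = nothing

  module Solver = RingSolver _ (toAlmostCommutativeRing commRing) ι-morphism ι-≟
  open Solver using (solve; _:=_; _:+_; _:*_; _:-_; :-_)

  brk≢0 : ∀ a → brk a ≢ 0ℤ
  brk≢0 (+ zero) ()
  brk≢0 (+ suc n) ()
  brk≢0 -[1+ n ] ()

  brk-nonzero : ∀ {a} → a ≢ 0ℤ → brk a ≡ a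
  brk-nonzero {+ zero}  a≢0 = ⊥-elim (a≢0 ≡.refl)
  brk-nonzero {+ suc n} a≢0 = ≡.refl
  brk-nonzero { -[1+ n ]} a≢0 = ≡.refl

  fact : ℤ → K
  fact m = fromℚ (brkFact m)

  factInv : ℤ → K
  factInv m = fromℚ (brkFactInv m)

  fact*factInv : ∀ m → fact m * factInv m ≈ 1#
  fact*factInv m = trans (sym (fromℚ-* _ _)) (trans (≡⇒≈ (cong fromℚ (brkFact-inverse m))) fromℚ-1)

  factInv*fact : ∀ m → factInv m * fact m ≈ 1#
  factInv*fact m = trans (*-comm _ _) (fact*factInv m)

  fact-nonzero : ∀ m → ¬ (fact m ≈ 0#)
  fact-nonzero m fm≈0 = nontrivial (trans (sym (fact*factInv m)) (trans (*-congʳ fm≈0) (zeroˡ _)))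

  fact-0 : fact 0ℤ ≈ 1#
  fact-0 = fromℚ-1

  sumFrom-cong : ∀ lo n {f g : ℤ → K} → (∀ k → k ℕ.< n → f (lo +ᶻ + k) ≈ g (lo +ᶻ + k)) →
                 sumFrom lo n f ≈ sumFrom lo n g
  sumFrom-cong lo zero    f≈g = refl
  sumFrom-cong lo (suc n) {f} {g} f≈g = +-cong
    (subst₂ (λ i j → f i ≈ g j) (ℤP.+-identityʳ lo) (ℤP.+-identityʳ lo) (f≈g 0 (ℕ.s≤s ℕ.z≤n)))
    (sumFrom-cong (lo +ᶻ 1ℤ) n λ k k<n →
      subst₂ (λ i j → f i ≈ g j) (≡.sym (ℤP.+-assoc lo 1ℤ (+ k))) (≡.sym (ℤP.+-assoc lo 1ℤ (+ k)))
             (f≈g (suc k) (ℕ.s≤s k<n)))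

  sumFrom-zero : ∀ lo n → sumFrom lo n (λ _ → 0#) ≈ 0#
  sumFrom-zero lo zero    = refl
  sumFrom-zero lo (suc n) = trans (+-identityˡ _) (sumFrom-zero (lo +ᶻ 1ℤ) n)

  sumFrom-+ : ∀ lo n (f g : ℤ → K) → sumFrom lo n (λ i → f i + g i) ≈ sumFrom lo n f + sumFrom lo n g
  sumFrom-+ lo zero    f g = sym (+-identityʳ 0#)
  sumFrom-+ lo (suc n) f g =
    trans (+-congˡ (sumFrom-+ (lo +ᶻ 1ℤ) n f g)) (interchange (f lo) (g lo) _ _)

  sumFrom-*ˡ : ∀ lo n x (f : ℤ → K) → sumFrom lo n (λ i → x * f i) ≈ x * sumFrom lo n f
  sumFrom-*ˡ lo zero    x f = sym (zeroʳ x)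
  sumFrom-*ˡ lo (suc n) x f = trans (+-congˡ (sumFrom-*ˡ (lo +ᶻ 1ℤ) n x f)) (sym (distribˡ x (f lo) _))

  sumFrom-neg : ∀ lo n (f : ℤ → K) → sumFrom lo n (λ i → - f i) ≈ - sumFrom lo n f
  sumFrom-neg lo zero    f = sym -0#≈0#
  sumFrom-neg lo (suc n) f = trans (+-congˡ (sumFrom-neg (lo +ᶻ 1ℤ) n f)) (-‿+-comm (f lo) _)

  sumFrom-swap : ∀ lo n lo′ n′ (f : ℤ → ℤ → K) →
    sumFrom lo n (λ i → sumFrom lo′ n′ (f i)) ≈ sumFrom lo′ n′ (λ j → sumFrom lo n (λ i → f i j))
  sumFrom-swap lo zero    lo′ n′ f = sym (sumFrom-zero lo′ n′)
  sumFrom-swap lo (suc n) lo′ n′ f =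
    trans (+-congˡ (sumFrom-swap (lo +ᶻ 1ℤ) n lo′ n′ f)) (sym (sumFrom-+ lo′ n′ _ _))

  sumFrom-++ : ∀ lo m n (f : ℤ → K) → sumFrom lo (m ℕ.+ n) f ≈ sumFrom lo m f + sumFrom (lo +ᶻ + m) n f
  sumFrom-++ lo zero    n f =
    trans (≡⇒≈ (cong (λ l → sumFrom l n f) (≡.sym (ℤP.+-identityʳ lo)))) (sym (+-identityˡ _))
  sumFrom-++ lo (suc m) n f = begin
    f lo + sumFrom (lo +ᶻ 1ℤ) (m ℕ.+ n) f
      ≈⟨ +-congˡ (sumFrom-++ (lo +ᶻ 1ℤ) m n f) ⟩
    f lo + (sumFrom (lo +ᶻ 1ℤ) m f + sumFrom (lo +ᶻ 1ℤ +ᶻ + m) n f)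
      ≈⟨ +-assoc _ _ _ ⟨
    (f lo + sumFrom (lo +ᶻ 1ℤ) m f) + sumFrom (lo +ᶻ 1ℤ +ᶻ + m) n f
      ≡⟨ cong (λ l → (f lo + sumFrom (lo +ᶻ 1ℤ) m f) + sumFrom l n f) (ℤP.+-assoc lo 1ℤ (+ m)) ⟩
    (f lo + sumFrom (lo +ᶻ 1ℤ) m f) + sumFrom (lo +ᶻ + suc m) n f
      ∎

  sumFrom-shift : ∀ lo n c (f : ℤ → K) → sumFrom lo n (λ i → f (i +ᶻ c)) ≈ sumFrom (lo +ᶻ c) n f
  sumFrom-shift lo zero    c f = refl
  sumFrom-shift lo (suc n) c f = +-congˡ (trans (sumFrom-shift (lo +ᶻ 1ℤ) n c f)
    (≡⇒≈ (cong (λ l → sumFrom l n f) (comm lo c))))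
    where comm : ∀ lo c → lo +ᶻ 1ℤ +ᶻ c ≡ lo +ᶻ c +ᶻ 1ℤ
          comm = solve-∀

  sumFrom-reflect : ∀ lo n c (f : ℤ → K) →
    sumFrom lo n (λ i → f (c -ᶻ i)) ≈ sumFrom (c -ᶻ lo -ᶻ + n +ᶻ 1ℤ) n f
  sumFrom-reflect lo zero    c f = refl
  sumFrom-reflect lo (suc n) c f = begin
    f (c -ᶻ lo) + sumFrom (lo +ᶻ 1ℤ) n (λ i → f (c -ᶻ i))
      ≈⟨ +-congˡ (sumFrom-reflect (lo +ᶻ 1ℤ) n c f) ⟩
    f (c -ᶻ lo) + sumFrom (c -ᶻ (lo +ᶻ 1ℤ) -ᶻ + n +ᶻ 1ℤ) n f
      ≈⟨ +-comm _ _ ⟩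
    sumFrom (c -ᶻ (lo +ᶻ 1ℤ) -ᶻ + n +ᶻ 1ℤ) n f + f (c -ᶻ lo)
      ≡⟨ cong₂ (λ l t → sumFrom l n f + f t) (first c lo (+ n)) (last c lo (+ n)) ⟩
    sumFrom l′ n f + f (l′ +ᶻ + n)
      ≈⟨ +-congˡ (+-identityʳ _) ⟨
    sumFrom l′ n f + sumFrom (l′ +ᶻ + n) 1 f
      ≈⟨ sumFrom-++ l′ n 1 f ⟨
    sumFrom l′ (n ℕ.+ 1) f
      ≡⟨ cong (λ m → sumFrom l′ m f) (ℕP.+-comm n 1) ⟩
    sumFrom l′ (suc n) f
      ∎
    where
    l′ = c -ᶻ lo -ᶻ + suc n +ᶻ 1ℤ
    first : ∀ c lo n → c -ᶻ (lo +ᶻ 1ℤ) -ᶻ n +ᶻ 1ℤ ≡ c -ᶻ lo -ᶻ (1ℤ +ᶻ n) +ᶻ 1ℤ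
    first = solve-∀
    last : ∀ c lo n → c -ᶻ lo ≡ c -ᶻ lo -ᶻ (1ℤ +ᶻ n) +ᶻ 1ℤ +ᶻ n
    last = solve-∀

  -- Unfolded, sumRange exposes the Boolean test on its bounds, on which unification gets stuck.
  opaque
    ∑ : ℤ → ℤ → (ℤ → K) → K
    ∑ = sumRange

  opaque
    unfolding ∑

    ∑≡sumRange : ∀ lo hi f → ∑ lo hi f ≡ sumRange lo hi f
    ∑≡sumRange lo hi f = ≡.refl

    rangeLength : ℤ → ℤ → ℕ
    rangeLength lo hi = if lo ≤ᵇ hi then suc ∣ hi -ᶻ lo ∣ else 0

    rangeLength-≡ : ∀ lo hi n → hi +ᶻ 1ℤ ≡ lo +ᶻ + n → rangeLength lo hi ≡ n
    rangeLength-≡ lo hi zero e =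
      if-cong (≤ᵇ-> (+1≤⇒< (ℤP.≤-reflexive (≡.trans e (ℤP.+-identityʳ lo)))))
    rangeLength-≡ lo hi (suc n) e = ≡.trans
      (if-cong (≤ᵇ-≤ (subst (lo ≤_) (≡.sym hi≡) (ℤP.i≤i+j lo (+ n)))))
      (cong (λ i → suc ∣ i ∣) (≡.trans (cong (_-ᶻ lo) hi≡) (cancel lo (+ n))))
      where
      hi≡ : hi ≡ lo +ᶻ + n
      hi≡ = +ᶻ-cancelʳ 1ℤ _ _ (≡.trans e (assoc lo (+ n)))
        where assoc : ∀ lo n → lo +ᶻ (1ℤ +ᶻ n) ≡ lo +ᶻ n +ᶻ 1ℤ
              assoc = solve-∀
      cancel : ∀ lo n → lo +ᶻ n -ᶻ lo ≡ n
      cancel = solve-∀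

    ∑-sumFrom : ∀ lo hi n (f : ℤ → K) → hi +ᶻ 1ℤ ≡ lo +ᶻ + n → ∑ lo hi f ≡ sumFrom lo n f
    ∑-sumFrom lo hi n f e = cong (λ m → sumFrom lo m f) (rangeLength-≡ lo hi n e)

    ≤⇒rangeLength : ∀ {lo hi} → lo ≤ hi → hi +ᶻ 1ℤ ≡ lo +ᶻ + suc ∣ hi -ᶻ lo ∣
    ≤⇒rangeLength {lo} {hi} lo≤hi = ≡.trans (cong (_+ᶻ 1ℤ) (≤⇒≡+∣-∣ lo≤hi)) (assoc lo (+ ∣ hi -ᶻ lo ∣))
      where assoc : ∀ lo n → lo +ᶻ n +ᶻ 1ℤ ≡ lo +ᶻ (1ℤ +ᶻ n)
            assoc = solve-∀

    range-index≤ : ∀ lo hi k → k ℕ.< rangeLength lo hi → lo +ᶻ + k ≤ hi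
    range-index≤ lo hi k k<n with lo ≤ᵇ hi in eq
    ... | true  = subst (lo +ᶻ + k ≤_) (≡.sym (≤⇒≡+∣-∣ lo≤hi)) (ℤP.+-monoʳ-≤ lo (ℤ.+≤+ (ℕP.≤-pred k<n)))
      where lo≤hi : lo ≤ hi
            lo≤hi = ℤP.≤ᵇ⇒≤ (subst Data.Bool.T (≡.sym eq) _)
    ... | false with () ← k<n

    ∑-cong : ∀ lo hi {f g : ℤ → K} → (∀ i → lo ≤ i → i ≤ hi → f i ≈ g i) →
                    ∑ lo hi f ≈ ∑ lo hi g
    ∑-cong lo hi f≈g = sumFrom-cong lo (rangeLength lo hi) λ k k<n →
      f≈g _ (ℤP.i≤i+j lo (+ k)) (range-index≤ lo hi k k<n)

    ∑-zero : ∀ lo hi (f : ℤ → K) → (∀ i → lo ≤ i → i ≤ hi → f i ≈ 0#) → ∑ lo hi f ≈ 0#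
    ∑-zero lo hi f f≈0 = trans (∑-cong lo hi f≈0) (sumFrom-zero lo (rangeLength lo hi))

    ∑-empty : ∀ lo hi (f : ℤ → K) → hi < lo → ∑ lo hi f ≈ 0#
    ∑-empty lo hi f hi<lo = ≡⇒≈ (cong (λ b → sumFrom lo (if b then suc ∣ hi -ᶻ lo ∣ else 0) f) (≤ᵇ-> hi<lo))

    ∑-+ : ∀ lo hi (f g : ℤ → K) → ∑ lo hi (λ i → f i + g i) ≈ ∑ lo hi f + ∑ lo hi g
    ∑-+ lo hi = sumFrom-+ lo (rangeLength lo hi)

    ∑-*ˡ : ∀ lo hi x (f : ℤ → K) → ∑ lo hi (λ i → x * f i) ≈ x * ∑ lo hi f
    ∑-*ˡ lo hi = sumFrom-*ˡ lo (rangeLength lo hi)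

    ∑-neg : ∀ lo hi (f : ℤ → K) → ∑ lo hi (λ i → - f i) ≈ - ∑ lo hi f
    ∑-neg lo hi = sumFrom-neg lo (rangeLength lo hi)

    ∑-swap : ∀ lo hi lo′ hi′ (f : ℤ → ℤ → K) →
      ∑ lo hi (λ i → ∑ lo′ hi′ (f i)) ≈ ∑ lo′ hi′ (λ j → ∑ lo hi (λ i → f i j))
    ∑-swap lo hi lo′ hi′ = sumFrom-swap lo (rangeLength lo hi) lo′ (rangeLength lo′ hi′)

  ∑-*ʳ : ∀ lo hi x (f : ℤ → K) → ∑ lo hi (λ i → f i * x) ≈ ∑ lo hi f * x
  ∑-*ʳ lo hi x f = trans (∑-cong lo hi λ i _ _ → *-comm (f i) x)
                                (trans (∑-*ˡ lo hi x f) (*-comm x _))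

  ∑-cons : ∀ lo hi (f : ℤ → K) → lo ≤ hi → ∑ lo hi f ≡ f lo + ∑ (lo +ᶻ 1ℤ) hi f
  ∑-cons lo hi f lo≤hi = ≡.trans (∑-sumFrom lo hi _ f (≤⇒rangeLength lo≤hi))
    (cong (λ s → f lo + s) (≡.sym (∑-sumFrom (lo +ᶻ 1ℤ) hi _ f
      (≡.trans (≤⇒rangeLength lo≤hi) (≡.sym (ℤP.+-assoc lo 1ℤ (+ ∣ hi -ᶻ lo ∣)))))))

  ∑-split : ∀ lo mid hi (f : ℤ → K) → lo ≤ mid +ᶻ 1ℤ → mid ≤ hi →
                   ∑ lo hi f ≈ ∑ lo mid f + ∑ (mid +ᶻ 1ℤ) hi f
  ∑-split lo mid hi f lo≤mid+1 mid≤hi = begin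
    ∑ lo hi f                            ≡⟨ ∑-sumFrom lo hi (a ℕ.+ b) f hi+1≡ ⟩
    sumFrom lo (a ℕ.+ b) f                      ≈⟨ sumFrom-++ lo a b f ⟩
    sumFrom lo a f + sumFrom (lo +ᶻ + a) b f    ≡⟨ cong (λ l → sumFrom lo a f + sumFrom l b f) mid+1≡ ⟨
    sumFrom lo a f + sumFrom (mid +ᶻ 1ℤ) b f    ≡⟨ cong₂ _+_ (∑-sumFrom lo mid a f mid+1≡)
                                                             (∑-sumFrom (mid +ᶻ 1ℤ) hi b f hi+1≡′) ⟨
    ∑ lo mid f + ∑ (mid +ᶻ 1ℤ) hi f ∎
    where
    a = ∣ mid +ᶻ 1ℤ -ᶻ lo ∣
    b = ∣ hi -ᶻ mid ∣
    mid+1≡ : mid +ᶻ 1ℤ ≡ lo +ᶻ + a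
    mid+1≡ = ≤⇒≡+∣-∣ lo≤mid+1
    hi+1≡′ : hi +ᶻ 1ℤ ≡ mid +ᶻ 1ℤ +ᶻ + b
    hi+1≡′ = ≡.trans (cong (_+ᶻ 1ℤ) (≤⇒≡+∣-∣ mid≤hi)) (comm mid (+ b))
      where comm : ∀ x y → x +ᶻ y +ᶻ 1ℤ ≡ x +ᶻ 1ℤ +ᶻ y
            comm = solve-∀
    hi+1≡ : hi +ᶻ 1ℤ ≡ lo +ᶻ + (a ℕ.+ b)
    hi+1≡ = ≡.trans hi+1≡′ (≡.trans (cong (_+ᶻ + b) mid+1≡) (ℤP.+-assoc lo (+ a) (+ b)))

  ∑-extendʳ : ∀ lo hi hi′ (f : ℤ → K) → hi ≤ hi′ → (∀ i → hi < i → i ≤ hi′ → f i ≈ 0#) →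
                     ∑ lo hi f ≈ ∑ lo hi′ f
  ∑-extendʳ lo hi hi′ f hi≤hi′ f≈0 with lo ℤP.≤? hi +ᶻ 1ℤ
  ... | yes lo≤hi+1 = sym (begin
    ∑ lo hi′ f                              ≈⟨ ∑-split lo hi hi′ f lo≤hi+1 hi≤hi′ ⟩
    ∑ lo hi f + ∑ (hi +ᶻ 1ℤ) hi′ f   ≈⟨ +-congˡ (∑-zero _ _ f λ i hi+1≤i → f≈0 i (+1≤⇒< hi+1≤i)) ⟩
    ∑ lo hi f + 0#                          ≈⟨ +-identityʳ _ ⟩
    ∑ lo hi f                               ∎)
  ... | no lo≰hi+1 = trans (∑-empty lo hi f hi<lo)
                           (sym (∑-zero lo hi′ f λ i lo≤i → f≈0 i (ℤP.<-≤-trans hi<lo lo≤i)))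
    where hi<lo = ℤP.<-trans (i<i+1 hi) (ℤP.≰⇒> lo≰hi+1)

  ∑-extendˡ : ∀ lo′ lo hi (f : ℤ → K) → lo′ ≤ lo → (∀ i → lo′ ≤ i → i < lo → f i ≈ 0#) →
                     ∑ lo hi f ≈ ∑ lo′ hi f
  ∑-extendˡ lo′ lo hi f lo′≤lo f≈0 with lo ℤP.≤? hi +ᶻ 1ℤ
  ... | yes lo≤hi+1 = sym (begin
    ∑ lo′ hi f                                   ≈⟨ ∑-split lo′ (lo -ᶻ 1ℤ) hi f lo′≤ lo-1≤hi ⟩
    ∑ lo′ (lo -ᶻ 1ℤ) f + ∑ (lo -ᶻ 1ℤ +ᶻ 1ℤ) hi f
                                                        ≈⟨ +-congʳ (∑-zero _ _ f λ i lo′≤i i≤lo-1 → f≈0 i lo′≤i (≤-1⇒< i≤lo-1)) ⟩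
    0# + ∑ (lo -ᶻ 1ℤ +ᶻ 1ℤ) hi f                 ≈⟨ +-identityˡ _ ⟩
    ∑ (lo -ᶻ 1ℤ +ᶻ 1ℤ) hi f                      ≡⟨ cong (λ l → ∑ l hi f) (cancel lo) ⟩
    ∑ lo hi f                                    ∎)
    where
    cancel : ∀ x → x -ᶻ 1ℤ +ᶻ 1ℤ ≡ x
    cancel = solve-∀
    lo′≤ : lo′ ≤ lo -ᶻ 1ℤ +ᶻ 1ℤ
    lo′≤ = subst (lo′ ≤_) (≡.sym (cancel lo)) lo′≤lo
    lo-1≤hi : lo -ᶻ 1ℤ ≤ hi
    lo-1≤hi = subst (lo -ᶻ 1ℤ ≤_) (cancel′ hi) (ℤP.+-monoˡ-≤ -1ℤ lo≤hi+1)
      where cancel′ : ∀ x → x +ᶻ 1ℤ -ᶻ 1ℤ ≡ x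
            cancel′ = solve-∀
  ... | no lo≰hi+1 = trans (∑-empty lo hi f hi<lo)
                           (sym (∑-zero lo′ hi f λ i lo′≤i i≤hi → f≈0 i lo′≤i (ℤP.≤-<-trans i≤hi hi<lo)))
    where hi<lo = ℤP.<-trans (i<i+1 hi) (ℤP.≰⇒> lo≰hi+1)

  ∑-single : ∀ lo hi j (f : ℤ → K) → lo ≤ j → j ≤ hi → (∀ i → lo ≤ i → i ≤ hi → i ≢ j → f i ≈ 0#) →
                    ∑ lo hi f ≈ f j
  ∑-single lo hi j f lo≤j j≤hi f≈0 = begin
    ∑ lo hi f                 ≈⟨ ∑-extendˡ lo j hi f lo≤j (λ i lo≤i i<j →
                                          f≈0 i lo≤i (ℤP.<⇒≤ (ℤP.<-≤-trans i<j j≤hi)) (ℤP.<⇒≢ i<j)) ⟨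
    ∑ j hi f                  ≈⟨ ∑-extendʳ j j hi f j≤hi (λ i j<i i≤hi →
                                          f≈0 i (ℤP.≤-trans lo≤j (ℤP.<⇒≤ j<i)) i≤hi (λ i≡j → ℤP.<⇒≢ j<i (≡.sym i≡j))) ⟨
    ∑ j j f                   ≡⟨ ∑-cons j j f ℤP.≤-refl ⟩
    f j + ∑ (j +ᶻ 1ℤ) j f     ≈⟨ +-congˡ (∑-empty _ _ f (i<i+1 j)) ⟩
    f j + 0#                         ≈⟨ +-identityʳ _ ⟩
    f j                              ∎

  ∑-shift : ∀ lo hi c (f : ℤ → K) → ∑ lo hi (λ i → f (i +ᶻ c)) ≈ ∑ (lo +ᶻ c) (hi +ᶻ c) f
  ∑-shift lo hi c f with lo ℤP.≤? hi
  ... | no lo≰hi = trans (∑-empty lo hi _ hi<lo) (sym (∑-empty _ _ f (ℤP.+-monoˡ-< c hi<lo)))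
    where hi<lo = ℤP.≰⇒> lo≰hi
  ... | yes lo≤hi = begin
    ∑ lo hi (λ i → f (i +ᶻ c))  ≡⟨ ∑-sumFrom lo hi n _ hi+1≡ ⟩
    sumFrom lo n (λ i → f (i +ᶻ c))    ≈⟨ sumFrom-shift lo n c f ⟩
    sumFrom (lo +ᶻ c) n f              ≡⟨ ∑-sumFrom _ _ n f shifted ⟨
    ∑ (lo +ᶻ c) (hi +ᶻ c) f     ∎
    where
    n = suc ∣ hi -ᶻ lo ∣
    hi+1≡ = ≤⇒rangeLength lo≤hi
    shifted : hi +ᶻ c +ᶻ 1ℤ ≡ lo +ᶻ c +ᶻ + n
    shifted = ≡.trans (comm hi c 1ℤ) (≡.trans (cong (_+ᶻ c) hi+1≡) (comm lo (+ n) c))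
      where comm : ∀ x y z → x +ᶻ y +ᶻ z ≡ x +ᶻ z +ᶻ y
            comm = solve-∀

  ∑-reflect : ∀ lo hi c (f : ℤ → K) → ∑ lo hi (λ i → f (c -ᶻ i)) ≈ ∑ (c -ᶻ hi) (c -ᶻ lo) f
  ∑-reflect lo hi c f with lo ℤP.≤? hi
  ... | no lo≰hi = trans (∑-empty lo hi _ hi<lo)
                         (sym (∑-empty _ _ f (ℤP.+-monoʳ-< c (ℤP.neg-mono-< hi<lo))))
    where hi<lo = ℤP.≰⇒> lo≰hi
  ... | yes lo≤hi = begin
    ∑ lo hi (λ i → f (c -ᶻ i))        ≡⟨ ∑-sumFrom lo hi n _ hi+1≡ ⟩
    sumFrom lo n (λ i → f (c -ᶻ i))          ≈⟨ sumFrom-reflect lo n c f ⟩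
    sumFrom (c -ᶻ lo -ᶻ + n +ᶻ 1ℤ) n f       ≡⟨ cong (λ l → sumFrom l n f) first ⟩
    sumFrom (c -ᶻ hi) n f                    ≡⟨ ∑-sumFrom _ _ n f last ⟨
    ∑ (c -ᶻ hi) (c -ᶻ lo) f           ∎
    where
    n = suc ∣ hi -ᶻ lo ∣
    hi+1≡ = ≤⇒rangeLength lo≤hi
    hi≡ : hi ≡ lo +ᶻ + n -ᶻ 1ℤ
    hi≡ = ≡.trans (≡.sym (cancel hi)) (cong (_-ᶻ 1ℤ) hi+1≡)
      where cancel : ∀ x → x +ᶻ 1ℤ -ᶻ 1ℤ ≡ x
            cancel = solve-∀
    first : c -ᶻ lo -ᶻ + n +ᶻ 1ℤ ≡ c -ᶻ hi
    first = ≡.trans (regroup c lo (+ n)) (cong (λ h → c -ᶻ h) (≡.sym hi≡))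
      where regroup : ∀ c lo n → c -ᶻ lo -ᶻ n +ᶻ 1ℤ ≡ c -ᶻ (lo +ᶻ n -ᶻ 1ℤ)
            regroup = solve-∀
    last : c -ᶻ lo +ᶻ 1ℤ ≡ c -ᶻ hi +ᶻ + n
    last = ≡.trans (regroup c lo (+ n)) (cong (λ h → c -ᶻ h +ᶻ + n) (≡.sym hi≡))
      where regroup : ∀ c lo n → c -ᶻ lo +ᶻ 1ℤ ≡ c -ᶻ (lo +ᶻ n -ᶻ 1ℤ) +ᶻ n
            regroup = solve-∀

  -- From here on a series X is read in normalised coordinates: X_m is ⌊m⌉! times the
  -- coefficient of λ_m (see normalise), so that D^a acts by X_m ↦ X_{m+a}.

  DegreeAtMost : Series → ℤ → Set ℓ
  DegreeAtMost X d = ∀ m → d < m → coeff X m ≈ 0#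

  Bounded′ : Series → Set ℓ
  Bounded′ X = DegreeAtMost X (top X)

  infix 4 _≋_
  record _≋_ (X Y : Series) : Set ℓ where
    constructor mk≋
    field at : ∀ m → coeff X m ≈ coeff Y m
  open _≋_ public

  ≋-setoid : Setoid c ℓ
  ≋-setoid = record
    { Carrier = Series
    ; _≈_ = _≋_
    ; isEquivalence = record
      { refl  = mk≋ λ _ → refl
      ; sym   = λ X≋Y → mk≋ λ m → sym (at X≋Y m)
      ; trans = λ X≋Y Y≋Z → mk≋ λ m → trans (at X≋Y m) (at Y≋Z m)
      }
    }

  module ≋ = Setoid ≋-setoid
  module ≋-Reasoning = SetoidReasoning ≋-setoid

  infixl 6 _+ₛ_ _-ₛ_
  _+ₛ_ : Series → Series → Series
  X +ₛ Y = mkSeries (top X ⊔ top Y) (λ m → coeff X m + coeff Y m)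

  _-ₛ_ : Series → Series → Series
  X -ₛ Y = mkSeries (top X ⊔ top Y) (λ m → coeff X m - coeff Y m)

  -- δ sends λ_j to λ_{j+1} for j ≠ -1 and λ_{-1} to 0: it is the Roman shift of D itself.
  δ : Series → Series
  δ X = mkSeries (top X +ᶻ 1ℤ) (λ m → ι m * coeff X (m -ᶻ 1ℤ))

  -ₛ-bounded : ∀ {X Y} → Bounded′ X → Bounded′ Y → Bounded′ (X -ₛ Y)
  -ₛ-bounded X-bd Y-bd m ⊔<m = trans
    (+-cong (X-bd m (ℤP.≤-<-trans (ℤP.i≤i⊔j _ _) ⊔<m)) (-‿cong (Y-bd m (ℤP.≤-<-trans (ℤP.i≤j⊔i _ _) ⊔<m))))
    (trans (+-congˡ -0#≈0#) (+-identityʳ 0#))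

  scale-bounded : ∀ {X} x → Bounded′ X → Bounded′ (scale x X)
  scale-bounded x X-bd m top<m = trans (*-congˡ (X-bd m top<m)) (zeroʳ x)

  +ₛ-cong : ∀ {X X′ Y Y′} → X ≋ X′ → Y ≋ Y′ → X +ₛ Y ≋ X′ +ₛ Y′
  +ₛ-cong X≋X′ Y≋Y′ = mk≋ λ m → +-cong (at X≋X′ m) (at Y≋Y′ m)

  δ-cong : ∀ {X Y} → X ≋ Y → δ X ≋ δ Y
  δ-cong X≋Y = mk≋ λ m → *-congˡ (at X≋Y (m -ᶻ 1ℤ))

  δ-scale : ∀ x X → δ (scale x X) ≋ scale x (δ X)
  δ-scale x X = mk≋ λ m → solve 3 (λ i x y → i :* (x :* y) := x :* (i :* y)) refl (ι m) x (coeff X (m -ᶻ 1ℤ))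

  ⟨δ⟩≈0 : ∀ X → ⟨ δ X ⟩ ≈ 0#
  ⟨δ⟩≈0 X = trans (*-congʳ ι-0) (zeroˡ _)

  δ-degree : ∀ {X} d → DegreeAtMost X d → DegreeAtMost (δ X) (d +ᶻ 1ℤ)
  δ-degree d X-deg m d+1<m = trans (*-congˡ (X-deg _ (+1≤⇒< (<⇒≤-1 d+1<m)))) (zeroʳ _)

  δ-bounded : ∀ {X} → Bounded′ X → Bounded′ (δ X)
  δ-bounded {X} = δ-degree {X} (top X)

  effCoeff-below : ∀ h {a} → a < low h → effCoeff h a ≈ 0#
  effCoeff-below h a<low = ≡⇒≈ (if-cong (≤ᵇ-> a<low))

  effCoeff-from : ∀ h {a} → low h ≤ a → effCoeff h a ≡ opCoeff h a
  effCoeff-from h low≤a = if-cong (≤ᵇ-≤ low≤a)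

  nonzero⇒low≤ : ∀ h {a} → ¬ (effCoeff h a ≈ 0#) → low h ≤ a
  nonzero⇒low≤ h {a} hₐ≉0 with low h ℤP.≤? a
  ... | yes low≤a = low≤a
  ... | no  low≰a = ⊥-elim (hₐ≉0 (effCoeff-below h (ℤP.≰⇒> low≰a)))

  infix 4 _≈ₒ_
  _≈ₒ_ : Op → Op → Set ℓ
  h ≈ₒ k = ∀ a → effCoeff h a ≈ effCoeff k a

  IsPowerSeries : Op → Set ℓ
  IsPowerSeries h = ∀ a → a < 0ℤ → effCoeff h a ≈ 0#

  -- the m-th coefficient of h(D) X whenever X has degree ≤ T
  ▹-sum : Op → Series → ℤ → ℤ → K
  ▹-sum h X T m = ∑ (low h) (T -ᶻ m) (λ a → effCoeff h a * coeff X (m +ᶻ a))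

  infixr 7 _▹_
  _▹_ : Op → Series → Series
  h ▹ X = mkSeries (top X -ᶻ low h) (▹-sum h X (top X))

  ▹-bounded : ∀ h X → Bounded′ (h ▹ X)
  ▹-bounded h X m top-low<m = ∑-empty (low h) (top X -ᶻ m) _ (i-j<k⇒i-k<j {top X} top-low<m)

  ▹-sum-extend : ∀ h X {T T′} → DegreeAtMost X T → T ≤ T′ → ∀ m → ▹-sum h X T m ≈ ▹-sum h X T′ m
  ▹-sum-extend h X {T} X-deg T≤T′ m = ∑-extendʳ (low h) _ _ _ (ℤP.+-monoˡ-≤ (-ᶻ m) T≤T′) λ a T-m<a _ →
    trans (*-congˡ (X-deg _ (subst₂ _<_ (cancel T m) (ℤP.+-comm a m) (ℤP.+-monoˡ-< m T-m<a)))) (zeroʳ _)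
    where cancel : ∀ T m → T -ᶻ m +ᶻ m ≡ T
          cancel = solve-∀

  ▹-coeff : ∀ h {X T} → Bounded′ X → DegreeAtMost X T → ∀ m → coeff (h ▹ X) m ≈ ▹-sum h X T m
  ▹-coeff h {X} {T} X-bd X-deg m with ℤP.≤-total (top X) T
  ... | inj₁ top≤T = ▹-sum-extend h X X-bd top≤T m
  ... | inj₂ T≤top = sym (▹-sum-extend h X X-deg T≤top m)

  ▹-sum-from : ∀ h X T {L} → L ≤ low h → ∀ m →
               ▹-sum h X T m ≈ ∑ L (T -ᶻ m) (λ a → effCoeff h a * coeff X (m +ᶻ a))
  ▹-sum-from h X T L≤low m =
    ∑-extendˡ _ _ _ _ L≤low λ a _ a<low → trans (*-congʳ (effCoeff-below h a<low)) (zeroˡ _)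

  ▹-cong : ∀ h {X Y} → Bounded′ X → Bounded′ Y → X ≋ Y → h ▹ X ≋ h ▹ Y
  ▹-cong h {X} {Y} X-bd Y-bd X≋Y = mk≋ λ m → begin
    ▹-sum h X (top X) m   ≈⟨ ▹-coeff h X-bd X-deg m ⟩
    ▹-sum h X (top Y) m   ≈⟨ ∑-cong (low h) _ (λ a _ _ → *-congˡ (at X≋Y (m +ᶻ a))) ⟩
    ▹-sum h Y (top Y) m   ∎
    where X-deg : DegreeAtMost X (top Y)
          X-deg j top<j = trans (at X≋Y j) (Y-bd j top<j)

  ▹-congˡ : ∀ {h k} X → h ≈ₒ k → h ▹ X ≋ k ▹ X
  ▹-congˡ {h} {k} X h≈k = mk≋ λ m → begin
    ▹-sum h X (top X) m                                      ≈⟨ ▹-sum-from h X (top X) (ℤP.i⊓j≤i _ _) m ⟩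
    ∑ L (top X -ᶻ m) (λ a → effCoeff h a * coeff X (m +ᶻ a))  ≈⟨ ∑-cong L _ (λ a _ _ → *-congʳ (h≈k a)) ⟩
    ∑ L (top X -ᶻ m) (λ a → effCoeff k a * coeff X (m +ᶻ a))  ≈⟨ ▹-sum-from k X (top X) (ℤP.i⊓j≤j _ _) m ⟨
    ▹-sum k X (top X) m                                      ∎
    where L = low h ⊓ low k

  ▹--ₛ : ∀ h {X Y} → Bounded′ X → Bounded′ Y → h ▹ (X -ₛ Y) ≋ h ▹ X -ₛ h ▹ Y
  ▹--ₛ h {X} {Y} X-bd Y-bd = mk≋ λ m → begin
    ▹-sum h (X -ₛ Y) M m
      ≈⟨ ∑-cong (low h) _ (λ a _ _ → x[y-z]≈xy-xz _ _ _) ⟩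
    ∑ (low h) (M -ᶻ m) (λ a → x m a - y m a)
      ≈⟨ ∑-+ _ _ (x m) (λ a → - y m a) ⟩
    ▹-sum h X M m + ∑ (low h) (M -ᶻ m) (λ a → - y m a)
      ≈⟨ +-congˡ (∑-neg _ _ (y m)) ⟩
    ▹-sum h X M m - ▹-sum h Y M m
      ≈⟨ +-cong (▹-coeff h X-bd X-deg m) (-‿cong (▹-coeff h Y-bd Y-deg m)) ⟨
    coeff (h ▹ X) m - coeff (h ▹ Y) m
      ∎
    where
    M = top X ⊔ top Y
    x y : ℤ → ℤ → K
    x m a = effCoeff h a * coeff X (m +ᶻ a)
    y m a = effCoeff h a * coeff Y (m +ᶻ a)
    X-deg : DegreeAtMost X M
    X-deg j M<j = X-bd j (ℤP.≤-<-trans (ℤP.i≤i⊔j _ _) M<j)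
    Y-deg : DegreeAtMost Y M
    Y-deg j M<j = Y-bd j (ℤP.≤-<-trans (ℤP.i≤j⊔i _ _) M<j)

  ▹-scale : ∀ h x X → h ▹ scale x X ≋ scale x (h ▹ X)
  ▹-scale h x X = mk≋ λ m → trans
    (∑-cong (low h) _ λ a _ _ → solve 3 (λ e x y → e :* (x :* y) := x :* (e :* y)) refl
      (effCoeff h a) x (coeff X (m +ᶻ a)))
    (∑-*ˡ _ _ x λ a → effCoeff h a * coeff X (m +ᶻ a))

  ▹-degree : ∀ h {X} d → IsPowerSeries h → DegreeAtMost X d → DegreeAtMost (h ▹ X) d
  ▹-degree h {X} d h-ps X-deg m d<m = ∑-zero _ _ _ λ a _ _ → term a
    where
    term : ∀ a → effCoeff h a * coeff X (m +ᶻ a) ≈ 0#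
    term a with 0ℤ ℤP.≤? a
    ... | yes 0≤a = trans (*-congˡ (X-deg _ (ℤP.<-≤-trans d<m m≤m+a))) (zeroʳ _)
      where m≤m+a = subst (_≤ m +ᶻ a) (ℤP.+-identityʳ m) (ℤP.+-monoʳ-≤ m 0≤a)
    ... | no  0≰a = trans (*-congʳ (h-ps a (ℤP.≰⇒> 0≰a))) (zeroˡ _)

  ∂ : Op → Op
  ∂ h = mkOp (low h -ᶻ 1ℤ) (λ a → ι (a +ᶻ 1ℤ) * effCoeff h (a +ᶻ 1ℤ))

  ∂-coeff : ∀ h a → effCoeff (∂ h) a ≈ ι (a +ᶻ 1ℤ) * effCoeff h (a +ᶻ 1ℤ)
  ∂-coeff h a with low h -ᶻ 1ℤ ℤP.≤? a
  ... | yes low-1≤a = ≡⇒≈ (effCoeff-from (∂ h) low-1≤a)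
  ... | no  low-1≰a = trans (effCoeff-below (∂ h) (ℤP.≰⇒> low-1≰a))
    (sym (trans (*-congˡ (effCoeff-below h (≤-1⇒< (<⇒+1≤ (ℤP.≰⇒> low-1≰a))))) (zeroʳ _)))

  ▹-δ : ∀ h {X} → Bounded′ X → h ▹ δ X ≋ δ (h ▹ X) +ₛ ∂ h ▹ X
  ▹-δ h {X} X-bd = mk≋ λ m → begin
    ∑ (low h) (T +ᶻ 1ℤ -ᶻ m) (λ a → e a * (ι (m +ᶻ a) * x (m +ᶻ a -ᶻ 1ℤ)))
      ≈⟨ ∑-cong (low h) _ (λ a _ _ → leibniz m a) ⟩
    ∑ (low h) (T +ᶻ 1ℤ -ᶻ m) (λ a → ι m * (e a * x (m +ᶻ (a -ᶻ 1ℤ))) + ι a * e a * x (m +ᶻ (a -ᶻ 1ℤ)))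
      ≈⟨ ∑-+ _ _ _ _ ⟩
    ∑ (low h) (T +ᶻ 1ℤ -ᶻ m) (λ a → ι m * (e a * x (m +ᶻ (a -ᶻ 1ℤ))))
      + ∑ (low h) (T +ᶻ 1ℤ -ᶻ m) (λ a → ι a * e a * x (m +ᶻ (a -ᶻ 1ℤ)))
      ≈⟨ +-cong (shifted-part m) (sym (derivative-part m)) ⟩
    ι m * ▹-sum h X T (m -ᶻ 1ℤ) + ▹-sum (∂ h) X T m
      ∎
    where
    T = top X
    e = effCoeff h
    x = coeff X
    leibniz : ∀ m a → e a * (ι (m +ᶻ a) * x (m +ᶻ a -ᶻ 1ℤ)) ≈
                      ι m * (e a * x (m +ᶻ (a -ᶻ 1ℤ))) + ι a * e a * x (m +ᶻ (a -ᶻ 1ℤ))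
    leibniz m a = begin
      e a * (ι (m +ᶻ a) * x (m +ᶻ a -ᶻ 1ℤ))              ≈⟨ *-congˡ (*-cong (ι-+ m a) (≡⇒≈ (cong x (assoc m a)))) ⟩
      e a * ((ι m + ι a) * x (m +ᶻ (a -ᶻ 1ℤ)))           ≈⟨ solve 4 (λ e i j y → e :* ((i :+ j) :* y) := i :* (e :* y) :+ j :* e :* y)
                                                              refl (e a) (ι m) (ι a) (x (m +ᶻ (a -ᶻ 1ℤ))) ⟩
      ι m * (e a * x (m +ᶻ (a -ᶻ 1ℤ))) + ι a * e a * x (m +ᶻ (a -ᶻ 1ℤ)) ∎
      where assoc : ∀ m a → m +ᶻ a -ᶻ 1ℤ ≡ m +ᶻ (a -ᶻ 1ℤ)
            assoc = solve-∀
    shifted-part : ∀ m → ∑ (low h) (T +ᶻ 1ℤ -ᶻ m) (λ a → ι m * (e a * x (m +ᶻ (a -ᶻ 1ℤ)))) ≈ ι m * ▹-sum h X T (m -ᶻ 1ℤ)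
    shifted-part m = trans (∑-*ˡ _ _ (ι m) _) (*-congˡ (trans
      (∑-cong (low h) _ λ a _ _ → *-congˡ (≡⇒≈ (cong x (regroup₁ m a))))
      (≡⇒≈ (cong (λ hi → ∑ (low h) hi (λ a → e a * x (m -ᶻ 1ℤ +ᶻ a))) (regroup₂ T m)))))
      where regroup₁ : ∀ m a → m +ᶻ (a -ᶻ 1ℤ) ≡ m -ᶻ 1ℤ +ᶻ a
            regroup₁ = solve-∀
            regroup₂ : ∀ T m → T +ᶻ 1ℤ -ᶻ m ≡ T -ᶻ (m -ᶻ 1ℤ)
            regroup₂ = solve-∀
    derivative-part : ∀ m → ▹-sum (∂ h) X T m ≈ ∑ (low h) (T +ᶻ 1ℤ -ᶻ m) (λ a → ι a * e a * x (m +ᶻ (a -ᶻ 1ℤ)))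
    derivative-part m = begin
      ∑ (low h -ᶻ 1ℤ) (T -ᶻ m) (λ a → effCoeff (∂ h) a * x (m +ᶻ a))
        ≈⟨ ∑-cong (low h -ᶻ 1ℤ) _ (λ a _ _ → *-cong (∂-coeff h a) (≡⇒≈ (cong x (regroup₁ m a)))) ⟩
      ∑ (low h -ᶻ 1ℤ) (T -ᶻ m) (λ a → G (a +ᶻ 1ℤ))
        ≈⟨ ∑-shift _ _ 1ℤ G ⟩
      ∑ (low h -ᶻ 1ℤ +ᶻ 1ℤ) (T -ᶻ m +ᶻ 1ℤ) G
        ≡⟨ cong₂ (λ lo hi → ∑ lo hi G) (regroup₂ (low h)) (regroup₃ T m) ⟩
      ∑ (low h) (T +ᶻ 1ℤ -ᶻ m) G
        ∎
      where
      G : ℤ → K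
      G a = ι a * e a * x (m +ᶻ (a -ᶻ 1ℤ))
      regroup₁ : ∀ m a → m +ᶻ a ≡ m +ᶻ (a +ᶻ 1ℤ -ᶻ 1ℤ)
      regroup₁ = solve-∀
      regroup₂ : ∀ l → l -ᶻ 1ℤ +ᶻ 1ℤ ≡ l
      regroup₂ = solve-∀
      regroup₃ : ∀ T m → T -ᶻ m +ᶻ 1ℤ ≡ T +ᶻ 1ℤ -ᶻ m
      regroup₃ = solve-∀

  ⟨▹δ⟩ : ∀ h {X} → Bounded′ X → coeff (h ▹ δ X) 0ℤ ≈ coeff (∂ h ▹ X) 0ℤ
  ⟨▹δ⟩ h {X} X-bd = trans (at (▹-δ h X-bd) 0ℤ) (trans (+-congʳ (⟨δ⟩≈0 (h ▹ X))) (+-identityˡ _))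

  infixl 7 _*ₒ_
  _*ₒ_ : Op → Op → Op
  h *ₒ k = mkOp (low h +ᶻ low k) (λ a → ∑ (low h) (a -ᶻ low k) (λ i → effCoeff h i * effCoeff k (a -ᶻ i)))

  *ₒ-coeff : ∀ h k a → effCoeff (h *ₒ k) a ≈ ∑ (low h) (a -ᶻ low k) (λ i → effCoeff h i * effCoeff k (a -ᶻ i))
  *ₒ-coeff h k a with low h +ᶻ low k ℤP.≤? a
  ... | yes low≤a = ≡⇒≈ (effCoeff-from (h *ₒ k) low≤a)
  ... | no  low≰a = trans (effCoeff-below (h *ₒ k) (ℤP.≰⇒> low≰a)) (sym (∑-empty _ _ _
    (subst (a -ᶻ low k <_) (cancel (low h) (low k)) (ℤP.+-monoˡ-< (-ᶻ low k) (ℤP.≰⇒> low≰a)))))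
    where cancel : ∀ x y → x +ᶻ y -ᶻ y ≡ x
          cancel = solve-∀

  *ₒ-comm : ∀ h k → h *ₒ k ≈ₒ k *ₒ h
  *ₒ-comm h k a = begin
    effCoeff (h *ₒ k) a                                       ≈⟨ *ₒ-coeff h k a ⟩
    ∑ (low h) (a -ᶻ low k) g                                  ≡⟨ cong (λ lo → ∑ lo (a -ᶻ low k) g) (cancel a (low h)) ⟨
    ∑ (a -ᶻ (a -ᶻ low h)) (a -ᶻ low k) g                      ≈⟨ ∑-reflect (low k) (a -ᶻ low h) a g ⟨
    ∑ (low k) (a -ᶻ low h) (λ j → g (a -ᶻ j))                 ≈⟨ ∑-cong (low k) _ (λ j _ _ → trans
                                                                   (*-congˡ (≡⇒≈ (cong (effCoeff k) (cancel a j)))) (*-comm _ _)) ⟩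
    ∑ (low k) (a -ᶻ low h) (λ j → effCoeff k j * effCoeff h (a -ᶻ j)) ≈⟨ *ₒ-coeff k h a ⟨
    effCoeff (k *ₒ h) a                                       ∎
    where
    g : ℤ → K
    g i = effCoeff h i * effCoeff k (a -ᶻ i)
    cancel : ∀ a l → a -ᶻ (a -ᶻ l) ≡ l
    cancel = solve-∀

  *ₒ-▹ : ∀ h k {X} → Bounded′ X → (h *ₒ k) ▹ X ≋ h ▹ (k ▹ X)
  *ₒ-▹ h k {X} X-bd = mk≋ λ m → begin
    ∑ (lh +ᶻ lk) (T -ᶻ m) (λ a → effCoeff (h *ₒ k) a * x (m +ᶻ a))
      ≈⟨ ∑-cong (lh +ᶻ lk) _ (λ a _ a≤T-m → *-congʳ (trans (*ₒ-coeff h k a) (inner-window m a a≤T-m))) ⟩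
    ∑ (lh +ᶻ lk) (T -ᶻ m) (λ a → ∑ lh (T -ᶻ lk -ᶻ m) (λ i → eh i * ek (a -ᶻ i)) * x (m +ᶻ a))
      ≈⟨ ∑-cong (lh +ᶻ lk) _ (λ a _ _ → trans (sym (∑-*ʳ _ _ _ _)) (∑-cong lh _ λ i _ _ → *-assoc _ _ _)) ⟩
    ∑ (lh +ᶻ lk) (T -ᶻ m) (λ a → ∑ lh (T -ᶻ lk -ᶻ m) (λ i → eh i * (ek (a -ᶻ i) * x (m +ᶻ a))))
      ≈⟨ ∑-swap _ _ _ _ _ ⟩
    ∑ lh (T -ᶻ lk -ᶻ m) (λ i → ∑ (lh +ᶻ lk) (T -ᶻ m) (λ a → eh i * (ek (a -ᶻ i) * x (m +ᶻ a))))
      ≈⟨ ∑-cong lh _ (λ i lh≤i _ → trans (∑-*ˡ _ _ _ _) (*-congˡ (reindex m i lh≤i))) ⟩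
    ∑ lh (T -ᶻ lk -ᶻ m) (λ i → eh i * ∑ lk (T -ᶻ (m +ᶻ i)) (λ j → ek j * x (m +ᶻ i +ᶻ j)))
      ∎
    where
    lh = low h
    lk = low k
    T = top X
    x = coeff X
    eh = effCoeff h
    ek = effCoeff k
    inner-window : ∀ m a → a ≤ T -ᶻ m →
      ∑ lh (a -ᶻ lk) (λ i → eh i * ek (a -ᶻ i)) ≈ ∑ lh (T -ᶻ lk -ᶻ m) (λ i → eh i * ek (a -ᶻ i))
    inner-window m a a≤T-m = ∑-extendʳ lh _ _ _
      (subst (a -ᶻ lk ≤_) (swap T m lk) (ℤP.+-monoˡ-≤ (-ᶻ lk) a≤T-m))
      (λ i a-lk<i _ → trans (*-congˡ (effCoeff-below k (below a i a-lk<i))) (zeroʳ _))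
      where
      swap : ∀ T m lk → T -ᶻ m -ᶻ lk ≡ T -ᶻ lk -ᶻ m
      swap = solve-∀
      below : ∀ a i → a -ᶻ lk < i → a -ᶻ i < lk
      below a i a-lk<i = subst₂ _<_ (regroup a lk i) (cancel lk i) (ℤP.+-monoˡ-< (lk -ᶻ i) a-lk<i)
        where regroup : ∀ a lk i → a -ᶻ lk +ᶻ (lk -ᶻ i) ≡ a -ᶻ i
              regroup = solve-∀
              cancel : ∀ lk i → i +ᶻ (lk -ᶻ i) ≡ lk
              cancel = solve-∀
    reindex : ∀ m i → lh ≤ i →
      ∑ (lh +ᶻ lk) (T -ᶻ m) (λ a → ek (a -ᶻ i) * x (m +ᶻ a)) ≈ ∑ lk (T -ᶻ (m +ᶻ i)) (λ j → ek j * x (m +ᶻ i +ᶻ j))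
    reindex m i lh≤i = begin
      ∑ (lh +ᶻ lk) (T -ᶻ m) (λ a → ek (a -ᶻ i) * x (m +ᶻ a))
        ≈⟨ ∑-extendˡ (lh +ᶻ lk) (lk +ᶻ i) _ _ lh+lk≤lk+i (λ a _ a<lk+i →
             trans (*-congʳ (effCoeff-below k (below a a<lk+i))) (zeroˡ _)) ⟨
      ∑ (lk +ᶻ i) (T -ᶻ m) (λ a → ek (a -ᶻ i) * x (m +ᶻ a))
        ≈⟨ ∑-cong (lk +ᶻ i) _ (λ a _ _ → *-congˡ (≡⇒≈ (cong x (regroup m i a)))) ⟩
      ∑ (lk +ᶻ i) (T -ᶻ m) (λ a → G (a +ᶻ -ᶻ i))
        ≈⟨ ∑-shift _ _ (-ᶻ i) G ⟩
      ∑ (lk +ᶻ i +ᶻ -ᶻ i) (T -ᶻ m +ᶻ -ᶻ i) G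
        ≡⟨ cong₂ (λ lo hi → ∑ lo hi G) (cancel lk i) (assoc T m i) ⟩
      ∑ lk (T -ᶻ (m +ᶻ i)) G
        ∎
      where
      G : ℤ → K
      G j = ek j * x (m +ᶻ i +ᶻ j)
      lh+lk≤lk+i : lh +ᶻ lk ≤ lk +ᶻ i
      lh+lk≤lk+i = subst (lh +ᶻ lk ≤_) (ℤP.+-comm i lk) (ℤP.+-monoˡ-≤ lk lh≤i)
      cancel : ∀ lk i → lk +ᶻ i +ᶻ -ᶻ i ≡ lk
      cancel = solve-∀
      below : ∀ a → a < lk +ᶻ i → a -ᶻ i < lk
      below a a<lk+i = subst (a -ᶻ i <_) (cancel lk i) (ℤP.+-monoˡ-< (-ᶻ i) a<lk+i)
      regroup : ∀ m i a → m +ᶻ a ≡ m +ᶻ i +ᶻ (a +ᶻ -ᶻ i)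
      regroup = solve-∀
      assoc : ∀ T m i → T -ᶻ m +ᶻ -ᶻ i ≡ T -ᶻ (m +ᶻ i)
      assoc = solve-∀

  ▹-comm : ∀ h k {X} → Bounded′ X → h ▹ k ▹ X ≋ k ▹ h ▹ X
  ▹-comm h k {X} X-bd = ≋.trans (≋.sym (*ₒ-▹ h k X-bd)) (≋.trans (▹-congˡ X (*ₒ-comm h k)) (*ₒ-▹ k h X-bd))

  1ₒ : Op
  1ₒ = mkOp 0ℤ (λ a → if does (a ℤ.≟ 0ℤ) then 1# else 0#)

  1ₒ-coeff-≢0 : ∀ {a} → a ≢ 0ℤ → effCoeff 1ₒ a ≈ 0#
  1ₒ-coeff-≢0 {a} a≢0 with 0ℤ ℤP.≤? a
  ... | yes 0≤a = ≡⇒≈ (≡.trans (effCoeff-from 1ₒ 0≤a) (if-cong (dec-false (a ℤ.≟ 0ℤ) a≢0)))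
  ... | no  0≰a = effCoeff-below 1ₒ (ℤP.≰⇒> 0≰a)

  1ₒ-▹ : ∀ {X} → Bounded′ X → 1ₒ ▹ X ≋ X
  1ₒ-▹ {X} X-bd = mk≋ λ m → case (m ℤP.≤? top X)
    where
    case : ∀ {m} → Dec (m ≤ top X) → coeff (1ₒ ▹ X) m ≈ coeff X m
    case {m} (yes m≤top) = trans
      (∑-single 0ℤ (top X -ᶻ m) 0ℤ _ ℤP.≤-refl (ℤP.i≤j⇒0≤j-i m≤top)
        (λ a _ _ a≢0 → trans (*-congʳ (1ₒ-coeff-≢0 a≢0)) (zeroˡ _)))
      (trans (*-identityˡ _) (≡⇒≈ (cong (coeff X) (ℤP.+-identityʳ m))))
    case {m} (no m≰top) = trans (∑-empty _ _ _ top-m<0) (sym (X-bd m (ℤP.≰⇒> m≰top)))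
      where top-m<0 = subst (top X -ᶻ m <_) (ℤP.+-inverseʳ m) (ℤP.+-monoˡ-< (-ᶻ m) (ℤP.≰⇒> m≰top))

  module BackSubstitution (N : ℤ) (A : ℤ → ℤ → K) (A-diagonal : ∀ m → ¬ (A m m ≈ 0#)) (s : ℤ → K) where

    distance : ℤ → ℕ
    distance b = ∣ N -ᶻ b ∣

    substitute : ℤ → (ℤ → K) → K
    substitute m d = proj₁ (inverse (A m m) (A-diagonal m)) * (s m - ∑ (m +ᶻ 1ℤ) N (λ b → d b * A b m))

    substitute-solves : ∀ m d → substitute m d * A m m + ∑ (m +ᶻ 1ℤ) N (λ b → d b * A b m) ≈ s m
    substitute-solves m d = begin
      a⁻¹ * (s m - S) * a + S    ≈⟨ +-congʳ (trans (*-comm _ _) (sym (*-assoc _ _ _))) ⟩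
      a * a⁻¹ * (s m - S) + S    ≈⟨ +-congʳ (*-congʳ (proj₂ (inverse a (A-diagonal m)))) ⟩
      1# * (s m - S) + S         ≈⟨ +-congʳ (*-identityˡ _) ⟩
      (s m - S) + S              ≈⟨ solve 2 (λ x y → x :- y :+ y := x) refl (s m) S ⟩
      s m                        ∎
      where
      a = A m m
      a⁻¹ = proj₁ (inverse a (A-diagonal m))
      S = ∑ (m +ᶻ 1ℤ) N (λ b → d b * A b m)

    -- table j k is the unknown at N - k once the unknowns at N, N - 1, …, N - j are computed
    table : ℕ → ℕ → K
    previous : ℕ → ℤ → K

    table zero    k = substitute (N -ᶻ + 0) (previous 0)
    table (suc j) k = if does (k ℕ.≤? j) then table j k else substitute (N -ᶻ + suc j) (previous (suc j))

    previous zero    b = 0#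
    previous (suc j) b = table j (distance b)

    table-stable : ∀ j k → k ℕ.≤ j → table j k ≡ table k k
    table-stable zero    .zero ℕ.z≤n = ≡.refl
    table-stable (suc j) k k≤suc-j with k ℕ.≤? j
    ... | yes k≤j = ≡.trans (if-cong (dec-true (k ℕ.≤? j) k≤j)) (table-stable j k k≤j)
    ... | no  k≰j rewrite ℕP.≤-antisym k≤suc-j (ℕP.≰⇒> k≰j) = ≡.refl

    table-diagonal : ∀ k → table k k ≡ substitute (N -ᶻ + k) (previous k)
    table-diagonal zero    = ≡.refl
    table-diagonal (suc j) = if-cong (dec-false (suc j ℕ.≤? j) (ℕP.<-irrefl ≡.refl))

    solution : ℤ → K
    solution b = table (distance b) (distance b)

    solution-diagonal : ∀ {m} → m ≤ N → solution m ≡ substitute m (previous (distance m))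
    solution-diagonal {m} m≤N = ≡.trans (table-diagonal (distance m))
      (cong (λ x → substitute x (previous (distance m))) (≡.trans
        (cong (λ d → N -ᶻ d) (ℤP.0≤i⇒+∣i∣≡i (ℤP.i≤j⇒0≤j-i m≤N))) (cancel N m)))
      where cancel : ∀ N m → N -ᶻ (N -ᶻ m) ≡ m
            cancel = solve-∀

    solution-previous : ∀ {m b} → m < b → b ≤ N → solution b ≡ previous (distance m) b
    solution-previous {m} {b} m<b b≤N with distance m | closer
      where
      closer : distance b ℕ.< distance m
      closer = ℤP.drop‿+<+ (subst₂ _<_
        (≡.sym (ℤP.0≤i⇒+∣i∣≡i (ℤP.i≤j⇒0≤j-i b≤N)))
        (≡.sym (ℤP.0≤i⇒+∣i∣≡i (ℤP.i≤j⇒0≤j-i (ℤP.<⇒≤ (ℤP.<-≤-trans m<b b≤N)))))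
        (ℤP.+-monoʳ-< N (ℤP.neg-mono-< m<b)))
    ... | suc j | ℕ.s≤s distance≤j = ≡.sym (table-stable j _ distance≤j)

    solves : ∀ m → m ≤ N → ∑ m N (λ b → solution b * A b m) ≈ s m
    solves m m≤N = begin
      ∑ m N (λ b → solution b * A b m)
        ≡⟨ ∑-cons m N _ m≤N ⟩
      solution m * A m m + ∑ (m +ᶻ 1ℤ) N (λ b → solution b * A b m)
        ≈⟨ +-cong (*-congʳ (≡⇒≈ (solution-diagonal m≤N))) (∑-cong (m +ᶻ 1ℤ) N λ b m+1≤b b≤N →
             *-congʳ (≡⇒≈ (solution-previous (+1≤⇒< m+1≤b) b≤N))) ⟩
      substitute m d * A m m + ∑ (m +ᶻ 1ℤ) N (λ b → d b * A b m)
        ≈⟨ substitute-solves m d ⟩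
      s m
        ∎
      where d = previous (distance m)

  backSubstitution : ∀ N (A : ℤ → ℤ → K) → (∀ m → ¬ (A m m ≈ 0#)) → ∀ s →
                     Σ (ℤ → K) λ d → ∀ m → m ≤ N → ∑ m N (λ b → d b * A b m) ≈ s m
  backSubstitution N A A-diagonal s = solution , solves
    where
    open BackSubstitution N A A-diagonal s

  module _ (w : Op) (w₀≉0 : ¬ (effCoeff w 0ℤ ≈ 0#)) where

    -- the coefficients d_b = u_{-b} (b ≤ 0) of the inverse u solve Σ_{m ≤ b ≤ 0} d_b w_{b-m} = [m = 0]
    private
      system : Σ (ℤ → K) λ d → ∀ m → m ≤ 0ℤ → ∑ m 0ℤ (λ b → d b * effCoeff w (b -ᶻ m)) ≈ effCoeff 1ₒ (-ᶻ m)
      system = backSubstitution 0ℤ (λ b m → effCoeff w (b -ᶻ m))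
        (λ m wₘₘ≈0 → w₀≉0 (trans (≡⇒≈ (cong (effCoeff w) (≡.sym (ℤP.+-inverseʳ m)))) wₘₘ≈0))
        (λ m → effCoeff 1ₒ (-ᶻ m))

    inverseₒ : Op
    inverseₒ = mkOp 0ℤ (λ a → proj₁ system (-ᶻ a))

    inverseₒ-powerSeries : IsPowerSeries inverseₒ
    inverseₒ-powerSeries a = effCoeff-below inverseₒ

    *ₒ-inverseₒ : IsPowerSeries w → w *ₒ inverseₒ ≈ₒ 1ₒ
    *ₒ-inverseₒ w-ps a with 0ℤ ℤP.≤? a
    ... | no 0≰a = trans (*ₒ-coeff w inverseₒ a) (trans
      (∑-zero _ _ _ λ i _ i≤a → trans (*-congʳ (w-ps i (ℤP.≤-<-trans i≤a a<0))) (zeroˡ _))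
      (sym (1ₒ-coeff-≢0 λ a≡0 → 0≰a (ℤP.≤-reflexive (≡.sym a≡0)))))
      where a<0 = subst (_< 0ℤ) (≡.sym (ℤP.+-identityʳ a)) (ℤP.≰⇒> 0≰a)
    ... | yes 0≤a = begin
      effCoeff (w *ₒ inverseₒ) a                       ≈⟨ *ₒ-coeff w inverseₒ a ⟩
      ∑ (low w) (a -ᶻ 0ℤ) (G a)                         ≈⟨ ∑-extendˡ (low w) 0ℤ _ (G a) (nonzero⇒low≤ w w₀≉0) (λ i _ i<0 →
                                                            trans (*-congʳ (w-ps i i<0)) (zeroˡ _)) ⟨
      ∑ 0ℤ (a -ᶻ 0ℤ) (G a)                              ≈⟨ ∑-cong 0ℤ _ (λ i _ i≤a → *-congˡ (≡⇒≈
                                                            (effCoeff-from inverseₒ (ℤP.i≤j⇒0≤j-i (subst (i ≤_) (ℤP.+-identityʳ a) i≤a))))) ⟩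
      ∑ 0ℤ (a -ᶻ 0ℤ) (H a)                              ≡⟨ cong₂ (λ lo hi → ∑ lo hi (H a)) (≡.sym (ℤP.+-inverseˡ a)) (shift0 a) ⟩
      ∑ (-ᶻ a +ᶻ a) (0ℤ +ᶻ a) (H a)                     ≈⟨ ∑-shift (-ᶻ a) 0ℤ a (H a) ⟨
      ∑ (-ᶻ a) 0ℤ (λ b → H a (b +ᶻ a))                  ≈⟨ ∑-cong (-ᶻ a) 0ℤ (λ b _ _ → trans
                                                            (*-cong (≡⇒≈ (cong (effCoeff w) (regroup₁ a b))) (≡⇒≈ (cong d (regroup₂ a b))))
                                                            (*-comm _ _)) ⟩
      ∑ (-ᶻ a) 0ℤ (λ b → d b * effCoeff w (b -ᶻ -ᶻ a))  ≈⟨ proj₂ system (-ᶻ a) (ℤP.neg-mono-≤ 0≤a) ⟩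
      effCoeff 1ₒ (-ᶻ -ᶻ a)                             ≡⟨ cong (effCoeff 1ₒ) (ℤP.neg-involutive a) ⟩
      effCoeff 1ₒ a                                     ∎
      where
      d = proj₁ system
      G H : ℤ → ℤ → K
      G a i = effCoeff w i * effCoeff inverseₒ (a -ᶻ i)
      H a i = effCoeff w i * d (-ᶻ (a -ᶻ i))
      shift0 : ∀ a → a -ᶻ 0ℤ ≡ 0ℤ +ᶻ a
      shift0 = solve-∀
      regroup₁ : ∀ a b → b +ᶻ a ≡ b -ᶻ -ᶻ a
      regroup₁ = solve-∀
      regroup₂ : ∀ a b → -ᶻ (a -ᶻ (b +ᶻ a)) ≡ b
      regroup₂ = solve-∀

  module _ {f : Op} (f-delta : IsDelta f) where

    ▹-delta-leading : ∀ {X} m → Bounded′ X → DegreeAtMost X (m +ᶻ 1ℤ) →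
                      coeff (f ▹ X) m ≈ effCoeff f 1ℤ * coeff X (m +ᶻ 1ℤ)
    ▹-delta-leading {X} m X-bd X-deg = begin
      coeff (f ▹ X) m                     ≈⟨ ▹-coeff f X-bd X-deg m ⟩
      ∑ (low f) (m +ᶻ 1ℤ -ᶻ m) term       ≡⟨ cong (λ hi → ∑ (low f) hi term) (cancel m) ⟩
      ∑ (low f) 1ℤ term                   ≈⟨ ∑-single _ _ 1ℤ term (nonzero⇒low≤ f (proj₂ f-delta)) ℤP.≤-refl
                                              (λ a _ a≤1 a≢1 → trans (*-congʳ (proj₁ f-delta a (<⇒≤-1 (ℤP.≤∧≢⇒< a≤1 a≢1))))
                                                                     (zeroˡ _)) ⟩
      effCoeff f 1ℤ * coeff X (m +ᶻ 1ℤ)   ∎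
      where
      term : ℤ → K
      term a = effCoeff f a * coeff X (m +ᶻ a)
      cancel : ∀ m → m +ᶻ 1ℤ -ᶻ m ≡ 1ℤ
      cancel = solve-∀

    ▹-delta-vanishing : ∀ {X} m → Bounded′ X → DegreeAtMost X m → coeff (f ▹ X) m ≈ 0#
    ▹-delta-vanishing {X} m X-bd X-deg = trans
      (▹-delta-leading m X-bd (λ j m+1<j → X-deg j (ℤP.<-trans (i<i+1 m) m+1<j)))
      (trans (*-congˡ (X-deg _ (i<i+1 m))) (zeroʳ _))

  -- uniqueness of associated sequences, in the form used to identify the Roman shift
  module _ {f : Op} (f-delta : IsDelta f) (E : ℤ → Series)
           (E-bounded : ∀ b → Bounded′ (E b)) (E-degree : ∀ b → DegreeAtMost (E b) (b +ᶻ 1ℤ))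
           (⟨E⟩≈0 : ∀ b → ⟨ E b ⟩ ≈ 0#) (f▹E : ∀ b → f ▹ E b ≋ scale (ι (brk b)) (E (b -ᶻ 1ℤ))) where

    private
      vanish-nonneg : ∀ n b i → b +ᶻ 1ℤ < + (i ℕ.+ n) → coeff (E b) (+ i) ≈ 0#
      vanish-nonneg zero    b i b+1<i  = E-degree b (+ i) (subst (λ k → b +ᶻ 1ℤ < + k) (ℕP.+-identityʳ i) b+1<i)
      vanish-nonneg (suc n) b zero _   = ⟨E⟩≈0 b
      vanish-nonneg (suc n) b (suc i) b+1<i+n = cancel-nonzeroʳ (proj₂ f-delta) (begin
        coeff (E b) (+ suc i) * effCoeff f 1ℤ      ≈⟨ *-comm _ _ ⟩
        effCoeff f 1ℤ * coeff (E b) (+ suc i)      ≡⟨ cong (λ k → effCoeff f 1ℤ * coeff (E b) k) (+i+1≡ i) ⟨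
        effCoeff f 1ℤ * coeff (E b) (+ i +ᶻ 1ℤ)    ≈⟨ ▹-delta-leading f-delta (+ i) (E-bounded b) above ⟨
        coeff (f ▹ E b) (+ i)                      ≈⟨ at (f▹E b) (+ i) ⟩
        ι (brk b) * coeff (E (b -ᶻ 1ℤ)) (+ i)      ≈⟨ *-congˡ (vanish-nonneg (suc n) (b -ᶻ 1ℤ) i previous) ⟩
        ι (brk b) * 0#                             ≈⟨ zeroʳ _ ⟩
        0#                                         ∎)
        where
        +i+1≡ : ∀ i → + i +ᶻ 1ℤ ≡ + suc i
        +i+1≡ i = cong +_ (ℕP.+-comm i 1)
        previous : b -ᶻ 1ℤ +ᶻ 1ℤ < + (i ℕ.+ suc n)
        previous = subst₂ _<_ (regroup b) ≡.refl (ℤP.+-monoˡ-< -1ℤ b+1<i+n)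
          where regroup : ∀ b → b +ᶻ 1ℤ -ᶻ 1ℤ ≡ b -ᶻ 1ℤ +ᶻ 1ℤ
                regroup = solve-∀
        above : DegreeAtMost (E b) (+ i +ᶻ 1ℤ)
        above j i+1<j = subst (λ k → coeff (E b) k ≈ 0#) +∣j∣≡j (vanish-nonneg n b ∣ j ∣ (ℤP.<-≤-trans b+1<i+n
          (ℤ.+≤+ (subst (ℕ._≤ ∣ j ∣ ℕ.+ n) (≡.sym (ℕP.+-suc (suc i) n)) (ℕP.+-monoˡ-≤ n i+2≤∣j∣)))))
          where
          i+2≤j : + suc (suc i) ≤ j
          i+2≤j = ℤP.i<j⇒suc[i]≤j (subst (_< j) (+i+1≡ i) i+1<j)
          +∣j∣≡j : + ∣ j ∣ ≡ j
          +∣j∣≡j = ℤP.0≤i⇒+∣i∣≡i (ℤP.≤-trans (ℤ.+≤+ ℕ.z≤n) i+2≤j)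
          i+2≤∣j∣ : suc (suc i) ℕ.≤ ∣ j ∣
          i+2≤∣j∣ = ℤP.drop‿+≤+ (subst (+ suc (suc i) ≤_) (≡.sym +∣j∣≡j) i+2≤j)

      vanish-from : ∀ j b m → -ᶻ + j ≤ m → coeff (E b) m ≈ 0#
      vanish-from zero b m 0≤m = subst (λ k → coeff (E b) k ≈ 0#) (ℤP.0≤i⇒+∣i∣≡i 0≤m)
        (vanish-nonneg (suc ∣ b +ᶻ 1ℤ ∣) b ∣ m ∣ (ℤP.≤-<-trans (i≤+∣i∣ (b +ᶻ 1ℤ))
          (ℤ.+<+ (subst (∣ b +ᶻ 1ℤ ∣ ℕ.<_) (≡.sym (ℕP.+-suc ∣ m ∣ _)) (ℕ.s≤s (ℕP.m≤n+m _ ∣ m ∣))))))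
      vanish-from (suc j) b m -j-1≤m = cancel-nonzeroʳ (ι-nonzero (brk≢0 (b +ᶻ 1ℤ))) (begin
        coeff (E b) m * ι (brk (b +ᶻ 1ℤ))                ≈⟨ *-comm _ _ ⟩
        ι (brk (b +ᶻ 1ℤ)) * coeff (E b) m                ≡⟨ cong (λ b′ → ι (brk (b +ᶻ 1ℤ)) * coeff (E b′) m) (cancel b) ⟨
        ι (brk (b +ᶻ 1ℤ)) * coeff (E (b +ᶻ 1ℤ -ᶻ 1ℤ)) m  ≈⟨ at (f▹E (b +ᶻ 1ℤ)) m ⟨
        coeff (f ▹ E (b +ᶻ 1ℤ)) m                        ≈⟨ ▹-delta-vanishing f-delta m (E-bounded _) (λ k m<k →
                                                              vanish-from j _ k (-j≤ k m<k)) ⟩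
        0#                                               ∎)
        where
        cancel : ∀ b → b +ᶻ 1ℤ -ᶻ 1ℤ ≡ b
        cancel = solve-∀
        -j≤ : ∀ k → m < k → -ᶻ + j ≤ k
        -j≤ k m<k = ℤP.≤-trans (ℤP.≤-reflexive (≡.sym (regroup (+ j))))
                               (ℤP.≤-trans (ℤP.+-monoˡ-≤ 1ℤ -j-1≤m) (<⇒+1≤ m<k))
          where regroup : ∀ j → -ᶻ (1ℤ +ᶻ j) +ᶻ 1ℤ ≡ -ᶻ j
                regroup = solve-∀

    family-vanishes : ∀ b m → coeff (E b) m ≈ 0#
    family-vanishes b m = vanish-from ∣ m ∣ b m (-+∣i∣≤i m)

  -- Σ_{b ≤ N} d_b Y_b for a family with deg Y_b ≤ b + c, so that only b ≥ m - c reach λ_m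
  combination : (ℤ → Series) → (ℤ → K) → ℤ → ℤ → Series
  combination Y d N c = mkSeries (N +ᶻ c) (λ m → ∑ (m -ᶻ c) N (λ b → d b * coeff (Y b) m))

  combination-bounded : ∀ Y d N c → Bounded′ (combination Y d N c)
  combination-bounded Y d N c m N+c<m = ∑-empty _ _ _
    (subst₂ _<_ (cancel N c) ≡.refl (ℤP.+-monoˡ-< (-ᶻ c) N+c<m))
    where cancel : ∀ N c → N +ᶻ c -ᶻ c ≡ N
          cancel = solve-∀

  combination-cong : ∀ {Y Y′} d N c → (∀ b → Y b ≋ Y′ b) → combination Y d N c ≋ combination Y′ d N c
  combination-cong d N c Y≋Y′ = mk≋ λ m → ∑-cong (m -ᶻ c) N λ b _ _ → *-congˡ (at (Y≋Y′ b) m)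

  δ-combination : ∀ Y d N c → δ (combination Y d N c) ≋ combination (λ b → δ (Y b)) d N (c +ᶻ 1ℤ)
  δ-combination Y d N c = mk≋ λ m → begin
    ι m * ∑ (m -ᶻ 1ℤ -ᶻ c) N (λ b → d b * coeff (Y b) (m -ᶻ 1ℤ))
      ≈⟨ ∑-*ˡ _ _ _ _ ⟨
    ∑ (m -ᶻ 1ℤ -ᶻ c) N (λ b → ι m * (d b * coeff (Y b) (m -ᶻ 1ℤ)))
      ≈⟨ ∑-cong _ N (λ b _ _ → solve 3 (λ x y z → x :* (y :* z) := y :* (x :* z)) refl
           (ι m) (d b) (coeff (Y b) (m -ᶻ 1ℤ))) ⟩
    ∑ (m -ᶻ 1ℤ -ᶻ c) N (λ b → d b * (ι m * coeff (Y b) (m -ᶻ 1ℤ)))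
      ≡⟨ cong (λ lo → ∑ lo N (λ b → d b * (ι m * coeff (Y b) (m -ᶻ 1ℤ)))) (regroup m c) ⟩
    ∑ (m -ᶻ (c +ᶻ 1ℤ)) N (λ b → d b * (ι m * coeff (Y b) (m -ᶻ 1ℤ)))
      ∎
    where regroup : ∀ m c → m -ᶻ 1ℤ -ᶻ c ≡ m -ᶻ (c +ᶻ 1ℤ)
          regroup = solve-∀

  ▹-combination : ∀ h Y d N c → (∀ b → Bounded′ (Y b)) → (∀ b → DegreeAtMost (Y b) (b +ᶻ c)) →
                  h ▹ combination Y d N c ≋ combination (λ b → h ▹ Y b) d N (c -ᶻ low h)
  ▹-combination h Y d N c Y-bd Y-deg = mk≋ λ m → begin
    ∑ (low h) (N +ᶻ c -ᶻ m) (λ a → e a * ∑ (m +ᶻ a -ᶻ c) N (λ b → d b * y b (m +ᶻ a)))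
      ≈⟨ ∑-cong (low h) _ (λ a low≤a _ → trans (*-congˡ (lower-window m a low≤a)) (sym (∑-*ˡ _ _ _ _))) ⟩
    ∑ (low h) (N +ᶻ c -ᶻ m) (λ a → ∑ (L m) N (λ b → e a * (d b * y b (m +ᶻ a))))
      ≈⟨ ∑-swap _ _ _ _ _ ⟩
    ∑ (L m) N (λ b → ∑ (low h) (N +ᶻ c -ᶻ m) (λ a → e a * (d b * y b (m +ᶻ a))))
      ≈⟨ ∑-cong (L m) N (λ b _ b≤N → trans
           (∑-cong (low h) _ λ a _ _ → solve 3 (λ x y z → x :* (y :* z) := y :* (x :* z)) refl (e a) (d b) (y b (m +ᶻ a)))
           (trans (∑-*ˡ _ _ _ _) (*-congˡ (sym (▹-coeff h (Y-bd b) (degree-N+c b b≤N) m))))) ⟩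
    ∑ (L m) N (λ b → d b * coeff (h ▹ Y b) m)
      ≡⟨ cong (λ lo → ∑ lo N (λ b → d b * coeff (h ▹ Y b) m)) (regroup m (low h) c) ⟩
    ∑ (m -ᶻ (c -ᶻ low h)) N (λ b → d b * coeff (h ▹ Y b) m)
      ∎
    where
    e = effCoeff h
    y = λ b → coeff (Y b)
    L : ℤ → ℤ
    L m = m +ᶻ low h -ᶻ c
    regroup : ∀ m l c → m +ᶻ l -ᶻ c ≡ m -ᶻ (c -ᶻ l)
    regroup = solve-∀
    lower-window : ∀ m a → low h ≤ a →
      ∑ (m +ᶻ a -ᶻ c) N (λ b → d b * y b (m +ᶻ a)) ≈ ∑ (L m) N (λ b → d b * y b (m +ᶻ a))
    lower-window m a low≤a = ∑-extendˡ (L m) _ N _ (ℤP.+-monoˡ-≤ (-ᶻ c) (ℤP.+-monoʳ-≤ m low≤a)) λ b _ b<m+a-c →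
      trans (*-congˡ (Y-deg b _ (subst (b +ᶻ c <_) (cancel (m +ᶻ a) c) (ℤP.+-monoˡ-< c b<m+a-c)))) (zeroʳ _)
      where cancel : ∀ x c → x -ᶻ c +ᶻ c ≡ x
            cancel = solve-∀
    degree-N+c : ∀ b → b ≤ N → DegreeAtMost (Y b) (N +ᶻ c)
    degree-N+c b b≤N j N+c<j = Y-deg b j (ℤP.≤-<-trans (ℤP.+-monoˡ-≤ c b≤N) N+c<j)

  ≈[]-sym : ∀ {z s t} → s ≈[ z ] t → t ≈[ z ] s
  ≈[]-sym s≈t m v = sym (s≈t m v)

  ≈[]-trans : ∀ {z s t w} → s ≈[ z ] t → t ≈[ z ] w → s ≈[ z ] w
  ≈[]-trans s≈t t≈w m v = trans (s≈t m v) (t≈w m v)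

  ≈[]-setoid : Bool → Setoid c ℓ
  ≈[]-setoid z = record
    { Carrier = Series
    ; _≈_ = _≈[ z ]_
    ; isEquivalence = record
      { refl  = λ _ _ → refl
      ; sym   = λ {s} {t} → ≈[]-sym {z} {s} {t}
      ; trans = λ {s} {t} {w} → ≈[]-trans {z} {s} {t} {w}
      }
    }

  module ≈[]-Reasoning (z : Bool) = SetoidReasoning (≈[]-setoid z)

  Bounded-false⇒Bounded : ∀ {z s} → Bounded false s → Bounded z s
  Bounded-false⇒Bounded s-bd m top<m _ = s-bd m top<m (inj₁ ≡.refl)

  ≈[false]⇒≈[] : ∀ {z s t} → s ≈[ false ] t → s ≈[ z ] t
  ≈[false]⇒≈[] s≈t m _ = s≈t m (inj₁ ≡.refl)

  visible : Bool → Series → Series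
  visible z s = mkSeries (top s) (mask z s)

  visible-≈ : ∀ z s → s ≈[ z ] visible z s
  visible-≈ false s m _ = refl
  visible-≈ true  s m (inj₂ 0≤m) = ≡⇒≈ (≡.sym (if-cong (cong not (≤ᵇ-≤ 0≤m))))

  visible-bounded : ∀ {z s} → Bounded z s → Bounded false (visible z s)
  visible-bounded {false} s-bd m top<m v = s-bd m top<m v
  visible-bounded {true} {s} s-bd m top<m _ with 0ℤ ℤP.≤? m
  ... | yes 0≤m = trans (≡⇒≈ (if-cong (cong not (≤ᵇ-≤ 0≤m)))) (s-bd m top<m (inj₂ 0≤m))
  ... | no  0≰m = ≡⇒≈ (if-cong (cong not (≤ᵇ-> (ℤP.≰⇒> 0≰m))))

  act-bounded : ∀ z h s → Bounded z (act z h s)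
  act-bounded z h s m top-low<m _ =
    trans (≡⇒≈ (≡.sym (∑≡sumRange _ _ _))) (∑-empty (low h) (top s -ᶻ m) _ (i-j<k⇒i-k<j {top s} top-low<m))

  combo-bounded : ∀ z p d N → Bounded z (combo p d N)
  combo-bounded z p d N m N<m _ = trans (≡⇒≈ (≡.sym (∑≡sumRange _ _ _))) (∑-empty m N _ N<m)

  normalise : Series → Series
  normalise s = mkSeries (top s) (λ m → fact m * coeff s m)

  normalise-bounded : ∀ {s} → Bounded false s → Bounded′ (normalise s)
  normalise-bounded s-bd m top<m = trans (*-congˡ (s-bd m top<m (inj₁ ≡.refl))) (zeroʳ _)

  normalise-cong : ∀ {s t} → s ≈[ false ] t → normalise s ≋ normalise t
  normalise-cong s≈t = mk≋ λ m → *-congˡ (s≈t m (inj₁ ≡.refl))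

  normalise-injective : ∀ {s t} → normalise s ≋ normalise t → s ≈[ false ] t
  normalise-injective {s} {t} s≋t m _ = begin
    coeff s m                          ≈⟨ *-identityˡ _ ⟨
    1# * coeff s m                     ≈⟨ *-congʳ (factInv*fact m) ⟨
    factInv m * fact m * coeff s m     ≈⟨ *-assoc _ _ _ ⟩
    factInv m * (fact m * coeff s m)   ≈⟨ *-congˡ (at s≋t m) ⟩
    factInv m * (fact m * coeff t m)   ≈⟨ *-assoc _ _ _ ⟨
    factInv m * fact m * coeff t m     ≈⟨ *-congʳ (factInv*fact m) ⟩
    1# * coeff t m                     ≈⟨ *-identityˡ _ ⟩
    coeff t m                          ∎

  ⟨normalise⟩ : ∀ s → coeff (normalise s) 0ℤ ≈ ⟨ s ⟩
  ⟨normalise⟩ s = trans (*-congʳ fact-0) (*-identityˡ _)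

  normalise-scale : ∀ x s → normalise (scale x s) ≋ scale x (normalise s)
  normalise-scale x s = mk≋ λ m → solve 3 (λ a b y → a :* (b :* y) := b :* (a :* y)) refl (fact m) x (coeff s m)

  normalise-act : ∀ h s → normalise (act false h s) ≋ h ▹ normalise s
  normalise-act h s = mk≋ λ m → begin
    fact m * sumRange (low h) (top s -ᶻ m) (g m)  ≡⟨ cong (fact m *_) (∑≡sumRange _ _ _) ⟨
    fact m * ∑ (low h) (top s -ᶻ m) (g m)         ≈⟨ ∑-*ˡ _ _ _ _ ⟨
    ∑ (low h) (top s -ᶻ m) (λ a → fact m * g m a) ≈⟨ ∑-cong (low h) _ (λ a low≤a _ → term m a low≤a) ⟩
    ∑ (low h) (top s -ᶻ m) (λ a → effCoeff h a * (fact (m +ᶻ a) * coeff s (m +ᶻ a))) ∎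
    where
    g : ℤ → ℤ → K
    g m a = opCoeff h a * (fromℚ (factRatio (m +ᶻ a) m) * coeff s (m +ᶻ a))
    term : ∀ m a → low h ≤ a → fact m * g m a ≈ effCoeff h a * (fact (m +ᶻ a) * coeff s (m +ᶻ a))
    term m a low≤a = begin
      fact m * (opCoeff h a * (fromℚ (factRatio (m +ᶻ a) m) * coeff s (m +ᶻ a)))
        ≈⟨ *-congˡ (*-congˡ (*-congʳ (fromℚ-* _ _))) ⟩
      fact m * (opCoeff h a * ((fact (m +ᶻ a) * factInv m) * coeff s (m +ᶻ a)))
        ≈⟨ solve 5 (λ f o f′ f⁻¹ x → f :* (o :* ((f′ :* f⁻¹) :* x)) := (f :* f⁻¹) :* (o :* (f′ :* x))) refl
             (fact m) (opCoeff h a) (fact (m +ᶻ a)) (factInv m) (coeff s (m +ᶻ a)) ⟩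
      (fact m * factInv m) * (opCoeff h a * (fact (m +ᶻ a) * coeff s (m +ᶻ a)))
        ≈⟨ trans (*-congʳ (fact*factInv m)) (*-identityˡ _) ⟩
      opCoeff h a * (fact (m +ᶻ a) * coeff s (m +ᶻ a))
        ≡⟨ cong (_* (fact (m +ᶻ a) * coeff s (m +ᶻ a))) (effCoeff-from h low≤a) ⟨
      effCoeff h a * (fact (m +ᶻ a) * coeff s (m +ᶻ a))
        ∎

  normalise-combo : ∀ p d N → normalise (combo p d N) ≋ combination (λ b → normalise (p b)) d N 0ℤ
  normalise-combo p d N = mk≋ λ m → begin
    fact m * sumRange m N (λ b → d b * coeff (p b) m)    ≡⟨ cong (fact m *_) (∑≡sumRange _ _ _) ⟨
    fact m * ∑ m N (λ b → d b * coeff (p b) m)           ≈⟨ ∑-*ˡ _ _ _ _ ⟨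
    ∑ m N (λ b → fact m * (d b * coeff (p b) m))          ≈⟨ ∑-cong m N (λ b _ _ →
                                                             solve 3 (λ x y z → x :* (y :* z) := y :* (x :* z)) refl
                                                               (fact m) (d b) (coeff (p b) m)) ⟩
    ∑ m N (λ b → d b * (fact m * coeff (p b) m))          ≡⟨ cong (λ lo → ∑ lo N (λ b → d b * (fact m * coeff (p b) m)))
                                                               (≡.sym (ℤP.+-identityʳ m)) ⟩
    ∑ (m -ᶻ 0ℤ) N (λ b → d b * (fact m * coeff (p b) m))  ∎

  ⟨act⟩ : ∀ h s → ⟨ act false h s ⟩ ≈ coeff (h ▹ normalise s) 0ℤ
  ⟨act⟩ h s = trans (sym (⟨normalise⟩ (act false h s))) (at (normalise-act h s) 0ℤ)

  monomial : ℤ → Series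
  monomial j = mkSeries j (λ m → if does (m ℤ.≟ j) then 1# else 0#)

  monomial-bounded : ∀ j → Bounded false (monomial j)
  monomial-bounded j m j<m _ = ≡⇒≈ (if-cong (dec-false (m ℤ.≟ j) λ m≡j → ℤP.<⇒≢ j<m (≡.sym m≡j)))

  ⟨act-monomial⟩ : ∀ h j → ⟨ act false h (monomial j) ⟩ ≈ effCoeff h j * fact j
  ⟨act-monomial⟩ h j = trans (⟨act⟩ h (monomial j)) (case (low h ℤP.≤? j))
    where
    term : ℤ → K
    term a = effCoeff h a * coeff (normalise (monomial j)) (0ℤ +ᶻ a)
    case : Dec (low h ≤ j) → ∑ (low h) (j -ᶻ 0ℤ) term ≈ effCoeff h j * fact j
    case (yes low≤j) = trans
      (∑-single _ _ j term low≤j (ℤP.≤-reflexive (≡.sym (ℤP.+-identityʳ j))) λ a _ _ a≢j →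
        trans (*-congˡ (trans (*-congˡ (≡⇒≈ (if-cong (dec-false (0ℤ +ᶻ a ℤ.≟ j) (λ e → a≢j (≡.trans (≡.sym (ℤP.+-identityˡ a)) e))))))
          (zeroʳ _))) (zeroʳ _))
      (*-congˡ (trans (*-cong (≡⇒≈ (cong fact (ℤP.+-identityˡ j)))
                              (≡⇒≈ (if-cong (dec-true (0ℤ +ᶻ j ℤ.≟ j) (ℤP.+-identityˡ j)))))
                      (*-identityʳ _)))
    case (no low≰j) = trans (∑-empty _ _ term (subst (_< low h) (≡.sym (ℤP.+-identityʳ j)) (ℤP.≰⇒> low≰j)))
      (sym (trans (*-congʳ (effCoeff-below h (ℤP.≰⇒> low≰j))) (zeroˡ _)))

  adjointImage-unique : ∀ {θ h k k′} → IsAdjointImage θ h k → IsAdjointImage θ h k′ → k ≈ₒ k′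
  adjointImage-unique {θ} {h} {k} {k′} adj adj′ j = *-cancelʳ (fact-nonzero j) (begin
    effCoeff k j * fact j                       ≈⟨ ⟨act-monomial⟩ k j ⟨
    ⟨ act false k (monomial j) ⟩                ≈⟨ adj (monomial j) (monomial-bounded j) ⟩
    ⟨ act false h (θ false (monomial j)) ⟩      ≈⟨ adj′ (monomial j) (monomial-bounded j) ⟨
    ⟨ act false k′ (monomial j) ⟩               ≈⟨ ⟨act-monomial⟩ k′ j ⟩
    effCoeff k′ j * fact j                      ∎)


module RomanShift {c ℓ} (F : CharZeroField c ℓ)
                  (f : Theory.Op F) (f-delta : Theory.IsDelta F f)
                  (p : Theory.Family F) (p-associated : Theory.IsAssociated F f p)
                  (σ : Bool → Theory.Series F → Theory.Series F) (σ-roman : Theory.IsRomanShift F p σ) where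

  open CharZeroField F
  open Theory F
  open Umbral F

  open RingProperties ring using (-0#≈0#; x∙y⁻¹≈ε⇒x≈y)
  open Solver using (solve; _:=_; _:+_; _:*_; _:-_)

  P : ℤ → Series
  P b = normalise (p b)

  P-bounded : ∀ b → Bounded′ (P b)
  P-bounded b = normalise-bounded (proj₁ (proj₁ p-associated b))

  P-degree : ∀ b → DegreeAtMost (P b) b
  P-degree b m b<m = trans (*-congˡ (proj₂ (proj₂ (proj₁ p-associated b)) m b<m)) (zeroʳ _)

  ⟨P⟩≈0 : ∀ {b} → b ≢ 0ℤ → coeff (P b) 0ℤ ≈ 0#
  ⟨P⟩≈0 {b} b≢0 = trans (⟨normalise⟩ (p b)) (proj₁ (proj₂ (proj₂ p-associated)) b b≢0)

  f▹P : ∀ b → f ▹ P b ≋ scale (ι (brk b)) (P (b -ᶻ 1ℤ))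
  f▹P b = ≋.trans (≋.sym (normalise-act f (p b)))
            (≋.trans (normalise-cong (proj₂ (proj₂ (proj₂ p-associated)) false b)) (normalise-scale _ _))

  notMinusOne : ℤ → K
  notMinusOne b = if does (b ℤ.≟ -1ℤ) then 0# else 1#

  brk-step : ∀ b → ι (brk b) * notMinusOne (b -ᶻ 1ℤ) + 1# ≈ notMinusOne b * ι (brk (b +ᶻ 1ℤ))
  brk-step b with b ℤ.≟ 0ℤ
  ... | yes ≡.refl = begin
    ι 1ℤ * 0# + 1#   ≈⟨ trans (+-congʳ (zeroʳ _)) (+-identityˡ _) ⟩
    1#               ≈⟨ trans (sym ι-1) (sym (*-identityˡ _)) ⟩
    1# * ι 1ℤ        ∎
    where
    open SetoidReasoning setoid
  ... | no b≢0 with b ℤ.≟ -1ℤ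
  ...   | yes ≡.refl = begin
    ι -1ℤ * 1# + 1#   ≈⟨ +-cong (trans (*-identityʳ _) (ι-neg 1ℤ)) (sym ι-1) ⟩
    - ι 1ℤ + ι 1ℤ     ≈⟨ -‿inverseˡ _ ⟩
    0#                ≈⟨ zeroˡ _ ⟨
    0# * ι 1ℤ         ∎
    where
    open SetoidReasoning setoid
  ...   | no b≢-1 = begin
    ι (brk b) * notMinusOne (b -ᶻ 1ℤ) + 1#   ≡⟨ cong₂ (λ x y → ι x * y + 1#) (brk-nonzero b≢0)
                                                 (if-cong (dec-false (b -ᶻ 1ℤ ℤ.≟ -1ℤ) (λ e → b≢0 (+ᶻ-cancelʳ -1ℤ _ _ e)))) ⟩
    ι b * 1# + 1#                            ≈⟨ +-cong (*-identityʳ _) (sym ι-1) ⟩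
    ι b + ι 1ℤ                               ≈⟨ ι-+ b 1ℤ ⟨
    ι (b +ᶻ 1ℤ)                              ≡⟨ cong ι (brk-nonzero (λ e → b≢-1 (+ᶻ-cancelʳ 1ℤ _ _ e))) ⟨
    ι (brk (b +ᶻ 1ℤ))                        ≈⟨ *-identityˡ _ ⟨
    1# * ι (brk (b +ᶻ 1ℤ))                   ∎
    where
    open SetoidReasoning setoid

  ∂f₀≉0 : ¬ (effCoeff (∂ f) 0ℤ ≈ 0#)
  ∂f₀≉0 ∂f₀≈0 = proj₂ f-delta (trans (sym (*-identityˡ _))
    (trans (*-congʳ (sym ι-1)) (trans (sym (∂-coeff f 0ℤ)) ∂f₀≈0)))

  ∂f⁻¹ : Op
  ∂f⁻¹ = inverseₒ (∂ f) ∂f₀≉0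

  ∂f⁻¹-powerSeries : IsPowerSeries ∂f⁻¹
  ∂f⁻¹-powerSeries = inverseₒ-powerSeries (∂ f) ∂f₀≉0

  ∂f▹∂f⁻¹▹ : ∀ {X} → Bounded′ X → ∂ f ▹ ∂f⁻¹ ▹ X ≋ X
  ∂f▹∂f⁻¹▹ {X} X-bd = ≋.trans (≋.sym (*ₒ-▹ (∂ f) ∂f⁻¹ X-bd)) (≋.trans (▹-congˡ X (*ₒ-inverseₒ (∂ f) ∂f₀≉0 ∂f-powerSeries)) (1ₒ-▹ X-bd))
    where ∂f-powerSeries : IsPowerSeries (∂ f)
          ∂f-powerSeries a a<0 = trans (∂-coeff f a) (trans (*-congˡ (proj₁ f-delta _ (<⇒+1≤ a<0))) (zeroʳ _))

  shift : Series → Series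
  shift X = δ (∂f⁻¹ ▹ X)

  shift-bounded : ∀ X → Bounded′ (shift X)
  shift-bounded X = δ-bounded (▹-bounded ∂f⁻¹ X)

  shift-cong : ∀ {X Y} → Bounded′ X → Bounded′ Y → X ≋ Y → shift X ≋ shift Y
  shift-cong X-bd Y-bd X≋Y = δ-cong (▹-cong ∂f⁻¹ X-bd Y-bd X≋Y)

  shift-scale : ∀ x X → shift (scale x X) ≋ scale x (shift X)
  shift-scale x X = ≋.trans (δ-cong (▹-scale ∂f⁻¹ x X)) (δ-scale x (∂f⁻¹ ▹ X))

  f▹shift : ∀ {X} → Bounded′ X → f ▹ shift X ≋ shift (f ▹ X) +ₛ X
  f▹shift {X} X-bd = begin
    f ▹ δ (∂f⁻¹ ▹ X)                      ≈⟨ ▹-δ f (▹-bounded ∂f⁻¹ X) ⟩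
    δ (f ▹ ∂f⁻¹ ▹ X) +ₛ ∂ f ▹ ∂f⁻¹ ▹ X    ≈⟨ +ₛ-cong (δ-cong (▹-comm f ∂f⁻¹ X-bd)) (∂f▹∂f⁻¹▹ X-bd) ⟩
    δ (∂f⁻¹ ▹ f ▹ X) +ₛ X                 ∎
    where
    open ≋-Reasoning

  Q : ℤ → Series
  Q b = scale (notMinusOne b) (P (b +ᶻ 1ℤ))

  private
    E : ℤ → Series
    E b = shift (P b) -ₛ Q b

    E-bounded : ∀ b → Bounded′ (E b)
    E-bounded b = -ₛ-bounded (shift-bounded (P b)) (scale-bounded _ (P-bounded _))

    E-degree : ∀ b → DegreeAtMost (E b) (b +ᶻ 1ℤ)
    E-degree b m b+1<m = trans
      (+-cong (δ-degree {∂f⁻¹ ▹ P b} b (▹-degree ∂f⁻¹ {P b} b ∂f⁻¹-powerSeries (P-degree b)) m b+1<m)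
              (-‿cong (trans (*-congˡ (P-degree _ m b+1<m)) (zeroʳ _))))
      (trans (+-congˡ -0#≈0#) (+-identityʳ _))

    ⟨E⟩≈0 : ∀ b → ⟨ E b ⟩ ≈ 0#
    ⟨E⟩≈0 b = trans (+-cong (⟨δ⟩≈0 (∂f⁻¹ ▹ P b)) (-‿cong ⟨Q⟩≈0)) (trans (+-congˡ -0#≈0#) (+-identityʳ _))
      where ⟨Q⟩≈0 : coeff (Q b) 0ℤ ≈ 0#
            ⟨Q⟩≈0 with b ℤ.≟ -1ℤ
            ... | yes ≡.refl = zeroˡ _
            ... | no  b≢-1   = trans (*-congˡ (⟨P⟩≈0 (λ e → b≢-1 (+ᶻ-cancelʳ 1ℤ _ _ e)))) (zeroʳ _)

    f▹E-coeff : ∀ b m → coeff (f ▹ E b) m ≈ ι (brk b) * coeff (E (b -ᶻ 1ℤ)) m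
    f▹E-coeff b m = begin
      coeff (f ▹ E b) m
        ≈⟨ at (▹--ₛ f (shift-bounded (P b)) (scale-bounded _ (P-bounded _))) m ⟩
      coeff (f ▹ shift (P b)) m - coeff (f ▹ Q b) m
        ≈⟨ +-cong (at (f▹shift (P-bounded b)) m) (-‿cong (at (▹-scale f _ (P (b +ᶻ 1ℤ))) m)) ⟩
      (coeff (shift (f ▹ P b)) m + x) - i * coeff (f ▹ P (b +ᶻ 1ℤ)) m
        ≈⟨ +-cong (+-congʳ (at shift-f▹P m)) (-‿cong (*-congˡ (at (f▹P (b +ᶻ 1ℤ)) m))) ⟩
      (β * T + x) - i * (ι (brk (b +ᶻ 1ℤ)) * coeff (P (b +ᶻ 1ℤ -ᶻ 1ℤ)) m)
        ≡⟨ cong (λ b′ → (β * T + x) - i * (ι (brk (b +ᶻ 1ℤ)) * coeff (P b′) m)) (cancel b) ⟩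
      (β * T + x) - i * (ι (brk (b +ᶻ 1ℤ)) * x)
        ≈⟨ +-congˡ (-‿cong (trans (sym (*-assoc _ _ _)) (*-congʳ (sym (brk-step b))))) ⟩
      (β * T + x) - (β * i′ + 1#) * x
        ≈⟨ +-congˡ (-‿cong (trans (distribʳ x (β * i′) 1#) (+-congˡ (*-identityˡ x)))) ⟩
      (β * T + x) - (β * i′ * x + x)
        ≈⟨ solve 4 (λ c T x i′ → (c :* T :+ x) :- (c :* i′ :* x :+ x) := c :* (T :- i′ :* x)) refl β T x i′ ⟩
      β * (T - i′ * x)
        ≡⟨ cong (λ b′ → β * (T - i′ * coeff (P b′) m)) (cancel′ b) ⟨
      β * coeff (E (b -ᶻ 1ℤ)) m
        ∎
      where
      open SetoidReasoning setoid
      β = ι (brk b)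
      i = notMinusOne b
      i′ = notMinusOne (b -ᶻ 1ℤ)
      x = coeff (P b) m
      T = coeff (shift (P (b -ᶻ 1ℤ))) m
      shift-f▹P : shift (f ▹ P b) ≋ scale β (shift (P (b -ᶻ 1ℤ)))
      shift-f▹P = ≋.trans (shift-cong (▹-bounded f (P b)) (scale-bounded β (P-bounded _)) (f▹P b)) (shift-scale β (P (b -ᶻ 1ℤ)))
      cancel : ∀ b → b +ᶻ 1ℤ -ᶻ 1ℤ ≡ b
      cancel = solve-∀
      cancel′ : ∀ b → b -ᶻ 1ℤ +ᶻ 1ℤ ≡ b
      cancel′ = solve-∀

  shift-P : ∀ b → shift (P b) ≋ Q b
  shift-P b = mk≋ λ m → x∙y⁻¹≈ε⇒x≈y _ _
    (family-vanishes f-delta E E-bounded E-degree ⟨E⟩≈0 (λ b → mk≋ (f▹E-coeff b)) b m)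

  expand : ∀ s → Bounded false s → Σ (ℤ → K) λ d → s ≈[ false ] combo p d (top s)
  expand s s-bd = d , λ m _ → by-position (m ℤP.≤? top s)
    where
    solution = backSubstitution (top s) (λ b m → coeff (p b) m)
                 (λ b → proj₁ (proj₂ (proj₁ p-associated b))) (coeff s)
    d = proj₁ solution
    by-position : ∀ {m} → Dec (m ≤ top s) → coeff s m ≈ coeff (combo p d (top s)) m
    by-position {m} (yes m≤top) = sym (trans (≡⇒≈ (≡.sym (∑≡sumRange _ _ _))) (proj₂ solution m m≤top))
    by-position {m} (no  m≰top) = trans (s-bd m (ℤP.≰⇒> m≰top) (inj₁ ≡.refl))
      (sym (combo-bounded false p d (top s) m (ℤP.≰⇒> m≰top) (inj₁ ≡.refl)))

  Q-combination : ∀ d N → combination Q d N 1ℤ ≋ combination P (shiftCoeffs d) (N +ᶻ 1ℤ) 0ℤ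
  Q-combination d N = mk≋ λ m → begin
    ∑ (m -ᶻ 1ℤ) N (λ b → d b * (notMinusOne b * coeff (P (b +ᶻ 1ℤ)) m))
      ≈⟨ ∑-cong (m -ᶻ 1ℤ) N (λ b _ _ → term m b) ⟩
    ∑ (m -ᶻ 1ℤ) N (λ b → G m (b +ᶻ 1ℤ))
      ≈⟨ ∑-shift (m -ᶻ 1ℤ) N 1ℤ (G m) ⟩
    ∑ (m -ᶻ 1ℤ +ᶻ 1ℤ) (N +ᶻ 1ℤ) (G m)
      ≡⟨ cong (λ lo → ∑ lo (N +ᶻ 1ℤ) (G m)) (regroup m) ⟩
    ∑ (m -ᶻ 0ℤ) (N +ᶻ 1ℤ) (G m)
      ∎
    where
    open SetoidReasoning setoid
    G : ℤ → ℤ → K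
    G m c = shiftCoeffs d c * coeff (P c) m
    regroup : ∀ m → m -ᶻ 1ℤ +ᶻ 1ℤ ≡ m -ᶻ 0ℤ
    regroup = solve-∀
    term : ∀ m b → d b * (notMinusOne b * coeff (P (b +ᶻ 1ℤ)) m) ≈ G m (b +ᶻ 1ℤ)
    term m b with b ℤ.≟ -1ℤ
    ... | yes ≡.refl = trans (*-congˡ (zeroˡ _)) (trans (zeroʳ _) (sym (zeroˡ _)))
    ... | no  b≢-1   = trans (*-congˡ (*-identityˡ _)) (*-congʳ (sym (≡⇒≈ (≡.trans
      (if-cong (dec-false (b +ᶻ 1ℤ ℤ.≟ 0ℤ) (λ e → b≢-1 (+ᶻ-cancelʳ 1ℤ _ _ e))))
      (cong d (cancel b))))))
      where cancel : ∀ b → b +ᶻ 1ℤ -ᶻ 1ℤ ≡ b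
            cancel = solve-∀

  shift-combination : ∀ d N → shift (combination P d N 0ℤ) ≋ combination P (shiftCoeffs d) (N +ᶻ 1ℤ) 0ℤ
  shift-combination d N = begin
    δ (∂f⁻¹ ▹ combination P d N 0ℤ)                  ≈⟨ δ-cong (▹-combination ∂f⁻¹ P d N 0ℤ P-bounded P-degree′) ⟩
    δ (combination (λ b → ∂f⁻¹ ▹ P b) d N 0ℤ)        ≈⟨ δ-combination (λ b → ∂f⁻¹ ▹ P b) d N 0ℤ ⟩
    combination (λ b → shift (P b)) d N 1ℤ        ≈⟨ combination-cong d N 1ℤ shift-P ⟩
    combination Q d N 1ℤ                          ≈⟨ Q-combination d N ⟩
    combination P (shiftCoeffs d) (N +ᶻ 1ℤ) 0ℤ    ∎
    where
    open ≋-Reasoning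
    P-degree′ : ∀ b → DegreeAtMost (P b) (b +ᶻ 0ℤ)
    P-degree′ b m b+0<m = P-degree b m (subst (_< m) (ℤP.+-identityʳ b) b+0<m)

  σ-visible : ∀ z s → Bounded z s → σ z s ≈[ z ] σ z (visible z s)
  σ-visible z s s-bd = proj₁ (proj₂ σ-roman) z s (visible z s) s-bd
    (Bounded-false⇒Bounded {z} {visible z s} (visible-bounded s-bd)) (visible-≈ z s)

  σ-image : ∀ s → Bounded false s → Series
  σ-image s s-bd = combo p (shiftCoeffs (proj₁ (expand s s-bd))) (top s +ᶻ 1ℤ)

  σ-expand : ∀ z s (s-bd : Bounded false s) → σ z s ≈[ z ] σ-image s s-bd
  σ-expand z s s-bd = ≈[]-trans {z} {σ z s} {σ z (combo p d (top s))} {σ-image s s-bd}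
    (proj₁ (proj₂ σ-roman) z s (combo p d (top s)) (Bounded-false⇒Bounded {z} {s} s-bd) (combo-bounded z p d (top s))
      (≈[false]⇒≈[] {z} {s} {combo p d (top s)} (proj₂ (expand s s-bd))))
    (proj₂ (proj₂ σ-roman) z d (top s))
    where d = proj₁ (expand s s-bd)

  normalise-σ : ∀ s → Bounded false s → normalise (σ false s) ≋ shift (normalise s)
  normalise-σ s s-bd = begin
    normalise (σ false s)                                ≈⟨ normalise-cong (σ-expand false s s-bd) ⟩
    normalise (combo p (shiftCoeffs d) (N +ᶻ 1ℤ))        ≈⟨ normalise-combo p (shiftCoeffs d) (N +ᶻ 1ℤ) ⟩
    combination P (shiftCoeffs d) (N +ᶻ 1ℤ) 0ℤ           ≈⟨ shift-combination d N ⟨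
    shift (combination P d N 0ℤ)                         ≈⟨ shift-cong (combination-bounded P d N 0ℤ) (normalise-bounded s-bd)
                                                              (≋.trans (≋.sym (normalise-combo p d N))
                                                                       (normalise-cong (≈[]-sym {false} {s} {combo p d N} s≈combo))) ⟩
    shift (normalise s)                                  ∎
    where
    open ≋-Reasoning
    N = top s
    d = proj₁ (expand s s-bd)
    s≈combo = proj₂ (expand s s-bd)


module Comparison {c ℓ} (F : CharZeroField c ℓ)
                  (f g : Theory.Op F) (p q : Theory.Family F) (σf σg : Bool → Theory.Series F → Theory.Series F)
                  (f-delta : Theory.IsDelta F f) (g-delta : Theory.IsDelta F g)
                  (p-associated : Theory.IsAssociated F f p) (q-associated : Theory.IsAssociated F g q)
                  (σf-roman : Theory.IsRomanShift F p σf) (σg-roman : Theory.IsRomanShift F q σg) where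

  open CharZeroField F
  open Theory F
  open Umbral F

  private
    module Sf = RomanShift F f f-delta p p-associated σf σf-roman
    module Sg = RomanShift F g g-delta q q-associated σg σg-roman

    f′⁻¹ g′⁻¹ : Op
    f′⁻¹ = Sf.∂f⁻¹
    g′⁻¹ = Sg.∂f⁻¹

  -- σ_f^*(g(D)) = g′(D) / f′(D)
  κ : Op
  κ = ∂ g *ₒ f′⁻¹

  shiftg-κ : ∀ {X} → Bounded′ X → Sg.shift (κ ▹ X) ≋ Sf.shift X
  shiftg-κ {X} X-bd = δ-cong (begin
    g′⁻¹ ▹ κ ▹ X              ≈⟨ ▹-cong g′⁻¹ (▹-bounded κ X) (▹-bounded (∂ g) (f′⁻¹ ▹ X)) (*ₒ-▹ (∂ g) f′⁻¹ X-bd) ⟩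
    g′⁻¹ ▹ ∂ g ▹ f′⁻¹ ▹ X     ≈⟨ ▹-comm g′⁻¹ (∂ g) (▹-bounded f′⁻¹ X) ⟩
    ∂ g ▹ g′⁻¹ ▹ f′⁻¹ ▹ X     ≈⟨ Sg.∂f▹∂f⁻¹▹ (▹-bounded f′⁻¹ X) ⟩
    f′⁻¹ ▹ X                  ∎)
    where
    open ≋-Reasoning

  κ-adjoint : IsAdjointImage σf g κ
  κ-adjoint s s-bd = begin
    ⟨ act false κ s ⟩                       ≈⟨ ⟨act⟩ κ s ⟩
    coeff (κ ▹ X) 0ℤ                        ≈⟨ at (*ₒ-▹ (∂ g) f′⁻¹ X-bd) 0ℤ ⟩
    coeff (∂ g ▹ f′⁻¹ ▹ X) 0ℤ               ≈⟨ ⟨▹δ⟩ g (▹-bounded f′⁻¹ X) ⟨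
    coeff (g ▹ Sf.shift X) 0ℤ               ≈⟨ at (▹-cong g (normalise-bounded (proj₁ σf-roman false s s-bd))
                                                 (Sf.shift-bounded X) (Sf.normalise-σ s s-bd)) 0ℤ ⟨
    coeff (g ▹ normalise (σf false s)) 0ℤ   ≈⟨ ⟨act⟩ g (σf false s) ⟨
    ⟨ act false g (σf false s) ⟩            ∎
    where
    open SetoidReasoning setoid
    X = normalise s
    X-bd = normalise-bounded s-bd

  σf≈σg∘k-false : ∀ k → IsAdjointImage σf g k → ∀ s → Bounded false s →
                    σf false s ≈[ false ] σg false (act false k s)
  σf≈σg∘k-false k k-adjoint s s-bd = normalise-injective (begin
    normalise (σf false s)              ≈⟨ Sf.normalise-σ s s-bd ⟩
    Sf.shift X                          ≈⟨ shiftg-κ X-bd ⟨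
    Sg.shift (κ ▹ X)                    ≈⟨ Sg.shift-cong (▹-bounded κ X) (▹-bounded k X)
                                             (▹-congˡ X (adjointImage-unique {σf} {g} {κ} {k} κ-adjoint k-adjoint)) ⟩
    Sg.shift (k ▹ X)                    ≈⟨ Sg.shift-cong (▹-bounded k X) (normalise-bounded t-bd) (≋.sym (normalise-act k s)) ⟩
    Sg.shift (normalise t)              ≈⟨ Sg.normalise-σ t t-bd ⟨
    normalise (σg false t)              ∎)
    where
    open ≋-Reasoning
    X = normalise s
    X-bd = normalise-bounded s-bd
    t = act false k s
    t-bd = act-bounded false k s

  σ-images : ∀ k → IsAdjointImage σf g k → ∀ s (s-bd : Bounded false s) →
             Sf.σ-image s s-bd ≈[ false ] Sg.σ-image (act false k s) (act-bounded false k s)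
  σ-images k k-adjoint s s-bd = begin
    Sf.σ-image s s-bd     ≈⟨ Sf.σ-expand false s s-bd ⟨
    σf false s            ≈⟨ σf≈σg∘k-false k k-adjoint s s-bd ⟩
    σg false t            ≈⟨ Sg.σ-expand false t t-bd ⟩
    Sg.σ-image t t-bd     ∎
    where
    open ≈[]-Reasoning false
    t = act false k s
    t-bd = act-bounded false k s

  σf≈σg∘k : ∀ k → IsAdjointImage σf g k → ∀ z s → Bounded z s → σf z s ≈[ z ] σg z (act z k s)
  σf≈σg∘k k k-adjoint z s s-bd = begin
    σf z s                    ≈⟨ Sf.σ-visible z s s-bd ⟩
    σf z s′                   ≈⟨ Sf.σ-expand z s′ s′-bd ⟩
    Sf.σ-image s′ s′-bd       ≈⟨ ≈[false]⇒≈[] {z} {Sf.σ-image s′ s′-bd} {Sg.σ-image t t-bd} (σ-images k k-adjoint s′ s′-bd) ⟩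
    Sg.σ-image t t-bd         ≈⟨ Sg.σ-expand z t t-bd ⟨
    σg z t                    ∎
    where
    open ≈[]-Reasoning z
    s′ = visible z s
    s′-bd = visible-bounded s-bd
    t = act false k s′
    t-bd = act-bounded false k s′

mainTheorem8 : ∀ {c ℓ} (F : CharZeroField c ℓ) → let open Theory F in
    ∀ (f g : Op) (p q : Family) (σf σg : Bool → Series → Series) →
    IsDelta f → IsDelta g → IsAssociated f p → IsAssociated g q →
    IsRomanShift p σf → IsRomanShift q σg →
    Σ Op (IsAdjointImage σf g)
    × (∀ k → IsAdjointImage σf g k →
    ∀ z s → Bounded z s → σf z s ≈[ z ] σg z (act z k s))
mainTheorem8 F f g p q σf σg f-delta g-delta p-associated q-associated σf-roman σg-roman =
  (κ , κ-adjoint) , σf≈σg∘k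
  where
  open Comparison F f g p q σf σg f-delta g-delta p-associated q-associated σf-roman σg-roman
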